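{- For every $i\in\{1,\dots,h\}$, the set $T$ returned by Algorithm 2 satisfies \[\mathbb{E}\big[|T\cap C_i|\ \big|\ \tau=0\big]\ \ge\ \frac14\sum_{e\in C_i\cap\mathrm{OPT}} p_{e,i}.\]
   Context: $M=(N,\mathcal{I})$ is a matroid with rank function $r$ and span $\mathrm{span}(A)=\{e\in N: r(A\cup\{e\})=r(A)\}$. Weights $w:N\to\mathbb{R}_{>0}$ are pairwise distinct, $\mathrm{OPT}$ is the maximum-weight independent set. Values $\tilde\rho\ge 1$, $W>0$ are given. Let $h=\lceil 3+\log_2\tilde{\rho}\rceil$ and $C_j=\{e\in N: w(e)\in (W/2^{h-j+1}, W/2^{h-j}]\}$ for $j\in\{1,\dots,h\}$, with $C_j=\varnothing$ for $j\le 0$ or $j>h$; $C_{\ge i}=\bigcup_{j=i}^h C_j$. A bucketing $\vec B=(B_1,\dots,B_b)$ partitions the weight classes into buckets $B_i=\bigcup_{j=f(B_i)}^{\ell(B_i)}C_j$ of consecutive classes with $f(B_1)=1$, $\ell(B_i)+1=f(B_{i+1})$, $\ell(B_b)=h$; $B_j=\varnothing$ for $j>b$, $f(B_j)=\ell(B_j)=0$ for $j\le 0$, $B_{\ge i}=\bigcup_{j\ge i}B_j$. For $S\subseteq N$ let $M_1=(M/(S\cap B_{\geq 2}))|_{B_1}$ and $M_i=(M/(S\cap B_{\geq i+1}))|_{B_i\cap \mathrm{span}(S\cap B_{\geq i-1})}$ for $i\in\{2,\dots,h\}$ (contraction then restriction), ground set $N_i$, independent sets $\mathcal{I}_i$.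 $H_{\mathrm{odd}},H_{\mathrm{even}}$ are the odd, resp. even, indices in $\{1,\dots,h\}$. Bucketing-based algorithm with input $\vec B$: $S$ contains each element independently with probability $1/2$ (observed, never selected); $H=H_{\mathrm{odd}}$ or $H_{\mathrm{even}}$ with probability $1/2$ each; $T_i=\varnothing$ for $i\in H$; for each $e\in N\setminus S$ as revealed (arbitrary order, possibly depending on $S$), with $e\in B_i$: if $i\in H$, $e\in N_i$ and $T_i\cup\{e\}\in\mathcal{I}_i$, add $e$ to $T_i$; return $T=\bigcup_{i\in H}T_i$. Algorithm 2: draw $\tau$ uniformly from $\{0,1,\dots,\lceil\log_2(h+1)\rceil\}$, then $\Delta$ uniformly from $\{0,\dots,2^\tau-1\}$; form the bucketing with $\lceil(h+\Delta)/2^\tau\rceil$ buckets $B_i=\bigcup_{j=2^\tau(i-1)-\Delta+1}^{2^\tau i-\Delta}C_j$; run the bucketing-based algorithm with this bucketing and return its output $T$. For $e\in N$, $i\in\{1,\dots,h\}$: $p_{e,i}=\Pr[e\in\mathrm{span}(S\cap C_{\ge i})\mid e\notin S]$ with $S$ containing each element independently with probability $1/2$; $p_{e,0}=1$.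
   Formalization: The weights take values in the positive rationals instead of $\mathbb{R}_{>0}$, and the given values $W$ and $\tilde\rho$ are rational as well. -}

module Defs where

open import Data.Bool using (Bool; true; false; not; _∧_; _∨_; if_then_else_)
open import Data.Nat as ℕ using (ℕ; zero; suc; _∸_; _^_; _≡ᵇ_; _⊔_) renaming (_+_ to _+ℕ_; _*_ to _*ℕ_; _≤ᵇ_ to _≤ℕᵇ_)
open import Data.Fin using (Fin)
open import Data.Vec using (Vec; []; _∷_; tabulate; lookup)
open import Data.List using (List; []; _∷_; _++_; map; foldr; foldl; filterᵇ; allFin; upTo; length)
open import Data.Bool.ListAction using (or)
open import Data.Fin.Subset using (Subset; ⊥; ⁅_⁆; _∈_; _∉_; _⊆_; _∪_; _∩_; ∣_∣)
open import Data.Product using (∃; _×_)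
open import Data.Rational using (ℚ; 0ℚ; 1ℚ; ½; _+_; _*_; _≤ᵇ_) renaming (_/_ to _/ℚ_)
open import Data.Rational.Properties using (_<?_)
open import Data.Integer using (+_)
open import Relation.Nullary.Decidable using (⌊_⌋)
open import Relation.Binary.PropositionalEquality using (_≡_)

allSubsets : (n : ℕ) → List (Subset n)
allSubsets zero = [] ∷ []
allSubsets (suc n) = map (false ∷_) (allSubsets n) ++ map (true ∷_) (allSubsets n)

_∈ᵇ_ : ∀ {n} → Fin n → Subset n → Bool
e ∈ᵇ A = lookup A e

_⊆ᵇ_ : ∀ {n} → Subset n → Subset n → Bool
[] ⊆ᵇ [] = true
(x ∷ xs) ⊆ᵇ (y ∷ ys) = (not x ∨ y) ∧ (xs ⊆ᵇ ys)

setOf : ∀ {n} → (Fin n → Bool) → Subset n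
setOf P = tabulate P

record Matroid (n : ℕ) : Set where
  field
    indep     : Subset n → Bool
    indep-∅   : indep ⊥ ≡ true
    indep-⊆   : ∀ A B → A ⊆ B → indep B ≡ true → indep A ≡ true
    indep-exch : ∀ A B → indep A ≡ true → indep B ≡ true → ∣ A ∣ ℕ.< ∣ B ∣ →
                 ∃ λ x → x ∈ B × x ∉ A × indep (A ∪ ⁅ x ⁆) ≡ true

open Matroid public

rank : ∀ {n} → Matroid n → Subset n → ℕ
rank {n} M A = foldr _⊔_ 0 (map ∣_∣ (filterᵇ (λ B → (B ⊆ᵇ A) ∧ indep M B) (allSubsets n)))

span : ∀ {n} → Matroid n → Subset n → Subset n
span M A = setOf (λ e → rank M (A ∪ ⁅ e ⁆) ≡ᵇ rank M A)

-- independence in (M / X)|_Y  (contraction by X, then restriction to Y ⊆ N ∖ X):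
-- I ⊆ Y, I ∩ X = ∅ and r(I ∪ X) = r(X) + |I|.
indepCR : ∀ {n} → Matroid n → (X Y I : Subset n) → Bool
indepCR M X Y I = (I ⊆ᵇ Y) ∧ (∣ I ∩ X ∣ ≡ᵇ 0) ∧ (rank M (I ∪ X) ≡ᵇ (rank M X +ℕ ∣ I ∣))

halfPow : ℕ → ℚ
halfPow zero = 1ℚ
halfPow (suc k) = ½ * halfPow k

toℚ : ℕ → ℚ
toℚ k = (+ k) /ℚ 1

_<ᵇ_ : ℚ → ℚ → Bool
p <ᵇ q = ⌊ p <? q ⌋

sumℚ : List ℚ → ℚ
sumℚ = foldr _+_ 0ℚ

count : ∀ {A : Set} → (A → Bool) → List A → ℕ
count P xs = length (filterᵇ P xs)

range : ℕ → ℕ → List ℕ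
range a b = filterᵇ (λ j → a ≤ℕᵇ j) (upTo (suc b))

weight : ∀ {n} → (Fin n → ℚ) → Subset n → ℚ
weight {n} w A = sumℚ (map w (filterᵇ (λ e → e ∈ᵇ A) (allFin n)))

-- Pr[A | B] for the uniform distribution on subsets S ⊆ Fin n
-- (each element in S independently with probability 1/2)
condProb : ∀ {n} → (Subset n → Bool) → (Subset n → Bool) → ℚ
condProb {n} A B with count B (allSubsets n)
... | zero = 0ℚ
... | suc k = (+ count (λ S → A S ∧ B S) (allSubsets n)) /ℚ suc k

module Classes {n : ℕ} (h : ℕ) (W : ℚ) (w : Fin n → ℚ) where

  inC : ℕ → Fin n → Bool
  inC j e = (1 ≤ℕᵇ j) ∧ (j ≤ℕᵇ h) ∧ ((W * halfPow (h ∸ j +ℕ 1)) <ᵇ w e) ∧ (w e ≤ᵇ (W * halfPow (h ∸ j)))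

  C : ℕ → Subset n
  C j = setOf (inC j)

  C≥ : ℕ → Subset n
  C≥ i = setOf (λ e → or (map (λ j → inC j e) (range i h)))

  p : Matroid n → Fin n → ℕ → ℚ
  p M e zero = 1ℚ
  p M e (suc k) = condProb (λ S → e ∈ᵇ span M (S ∩ C≥ (suc k))) (λ S → not (e ∈ᵇ S))

  -- Bucketing of Algorithm 2 for parameters τ, Δ:
  -- B_i = ⋃_{j = 2^τ (i-1) - Δ + 1}^{2^τ i - Δ} C_j  for i ≥ 1, B_i = ∅ for i ≤ 0.
  -- (Buckets with index > b = ⌈(h+Δ)/2^τ⌉ are automatically empty.)
  module Bucketing (τ Δ : ℕ) where

    inB : ℕ → Fin n → Bool
    inB zero e = false
    inB (suc k) e = or (map (λ j → ((2 ^ τ) *ℕ k +ℕ 1 ≤ℕᵇ j +ℕ Δ) ∧ (j +ℕ Δ ≤ℕᵇ (2 ^ τ) *ℕ suc k) ∧ inC j e)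
                            (range 1 h))

    B : ℕ → Subset n
    B i = setOf (inB i)

    -- B_{≥ i} = ⋃_{j ≥ i} B_j   (all nonempty buckets have index ≤ h + Δ)
    B≥ : ℕ → Subset n
    B≥ i = setOf (λ e → or (map (λ j → inB j e) (range i (h +ℕ Δ))))

    -- The matroids M_i determined by the sample S (given by contraction set X_i and
    -- ground set N_i; independence is indepCR M (X i) (Ngr i)).
    module Sample (M : Matroid n) (S : Subset n) where

      X : ℕ → Subset n
      X i = S ∩ B≥ (suc i)

      Ngr : ℕ → Subset n
      Ngr zero = ⊥
      Ngr (suc zero) = B 1
      Ngr (suc (suc k)) = B (suc (suc k)) ∩ span M (S ∩ B≥ (suc k))

      indepᵢ : ℕ → Subset n → Bool
      indepᵢ i I = indepCR M (X i) (Ngr i) I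

      stepᵢ : ℕ → Subset n → Fin n → Subset n
      stepᵢ i Tᵢ e =
        if not (e ∈ᵇ S) ∧ (e ∈ᵇ B i) ∧ (e ∈ᵇ Ngr i) ∧ indepᵢ i (Tᵢ ∪ ⁅ e ⁆)
        then Tᵢ ∪ ⁅ e ⁆ else Tᵢ

      Tᵢ : ℕ → List (Fin n) → Subset n
      Tᵢ i order = foldl (stepᵢ i) ⊥ order

      Hset : Bool → List ℕ
      Hset odd = filterᵇ (λ i → if odd then not (isEven i) else isEven i) (range 1 h)
        where
          isEven : ℕ → Bool
          isEven zero = true
          isEven (suc zero) = false
          isEven (suc (suc k)) = isEven k

      T : Bool → List (Fin n) → Subset n
      T odd order = foldr _∪_ ⊥ (map (λ i → Tᵢ i order) (Hset odd))

  -- E[ |T ∩ C_i| | τ ] for Algorithm 2: average over Δ ∈ {0,…,2^τ-1},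
  -- S uniform over subsets of Fin n, and H ∈ {H_odd, H_even} uniform.
  -- The revealing order is an arbitrary function of S.
  condExpTC : Matroid n → (Subset n → List (Fin n)) → (τ i : ℕ) → ℚ
  condExpTC M order τ i =
    sumℚ (map (λ Δ →
      sumℚ (map (λ S →
        sumℚ (map (λ odd →
          toℚ ∣ Bucketing.Sample.T τ Δ M S odd (order S) ∩ C i ∣
            * (halfPow τ * (halfPow n * ½)))
          (true ∷ false ∷ [])))
        (allSubsets n)))
      (upTo (2 ^ τ)))

{-# OPTIONS --safe #-}
module Submission where

-- Fix the sample S and suppose i ∈ H, which happens with probability 1/2.  For τ = 0 every
-- bucket is a single weight class, so T ∩ C_i contains T_i, the greedy output in M_i.  Let Z be
-- the elements of OPT heavier than the upper end of C_i; as OPT has maximum weight, Z spans every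
-- heavier element, in particular the contracted set X = S ∩ C_{≥ i+1}.  The elements Q of
-- C_i ∩ OPT outside S but spanned by S ∩ C_{≥ i} are candidates in M_i, so each is accepted or
-- spanned by T_i ∪ X.  Since Q ∪ Z ⊆ OPT is independent, |Q| + |Z| ≤ r(T_i ∪ X ∪ Z) ≤ |T_i| + |Z|.
-- Averaging |Q| over S counts each e ∈ C_i ∩ OPT with probability Pr[e ∉ S] · p_{e,i} = p_{e,i}/2.

open import Defs
open import Data.Nat as ℕ using (ℕ)
open import Data.List using (List; filterᵇ; allFin)
open import Data.List.Relation.Binary.Permutation.Propositional using (_↭_)
open import Data.Fin using (Fin)
open import Data.Fin.Subset using (Subset; _⊆_)
open import Data.Rational as ℚ using (ℚ; 0ℚ)
open import Relation.Binary.PropositionalEquality using (_≡_)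
open import Data.Bool using (true; not)

module FinSubset where

  open import Data.Bool using (Bool; false)
  open import Data.Nat using (suc; _+_; _≤_; _<_; s≤s)
  open import Data.Nat.Properties
  open import Data.Fin using (zero; suc)
  open import Data.Vec using ([]; _∷_; here; there)
  open import Data.Vec.Properties using ([]=⇒lookup; lookup⇒[]=; lookup∘tabulate)
  open import Data.Fin.Subset
  open import Data.Fin.Subset.Properties
  open import Data.Product using (∃; _×_; _,_)
  open import Data.Sum using (inj₁; inj₂)
  open import Data.List using (_∷_; foldr; map)
  open import Data.List.Membership.Propositional using () renaming (_∈_ to _∈ₗ_)
  open import Data.List.Relation.Unary.Any using () renaming (here to hereₗ; there to thereₗ)
  open import Function using (_⇔_; mk⇔; _∘_)
  open import Relation.Nullary using (contradiction)
  open import Relation.Binary.PropositionalEquality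

  private variable
    n : ℕ
    p q r : Subset n
    x : Fin n

  ∈⇒∈ᵇ : x ∈ p → x ∈ᵇ p ≡ true
  ∈⇒∈ᵇ = []=⇒lookup

  ∈ᵇ⇒∈ : x ∈ᵇ p ≡ true → x ∈ p
  ∈ᵇ⇒∈ {x = x} {p} = lookup⇒[]= x p

  ∉⇔not-∈ᵇ : x ∉ p ⇔ not (x ∈ᵇ p) ≡ true
  ∉⇔not-∈ᵇ {x = x} {p} = mk⇔ to from
    where
      to : x ∉ p → not (x ∈ᵇ p) ≡ true
      to x∉p with x ∈ᵇ p in x∈ᵇp
      ... | true = contradiction (∈ᵇ⇒∈ x∈ᵇp) x∉p
      ... | false = refl
      from : not (x ∈ᵇ p) ≡ true → x ∉ p
      from x∉ᵇp x∈p with x ∈ᵇ p | ∈⇒∈ᵇ x∈p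
      from () x∈p | true | _

  ∈-setOf : ∀ {P : Fin n → Bool} → x ∈ setOf P ⇔ P x ≡ true
  ∈-setOf {x = x} {P} = mk⇔
    (λ x∈ → trans (sym (lookup∘tabulate P x)) (∈⇒∈ᵇ x∈))
    (λ Px → ∈ᵇ⇒∈ (trans (lookup∘tabulate P x) Px))

  ⊆ᵇ⇒⊆ : ∀ (p q : Subset n) → (p ⊆ᵇ q) ≡ true → p ⊆ q
  ⊆ᵇ⇒⊆ (inside ∷ p) (inside ∷ q) _ here = here
  ⊆ᵇ⇒⊆ (true ∷ p) (true ∷ q) p⊆ᵇq (there x∈p) = there (⊆ᵇ⇒⊆ p q p⊆ᵇq x∈p)
  ⊆ᵇ⇒⊆ (false ∷ p) (_ ∷ q) p⊆ᵇq (there x∈p) = there (⊆ᵇ⇒⊆ p q p⊆ᵇq x∈p)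

  ⊆⇒⊆ᵇ : ∀ (p q : Subset n) → p ⊆ q → (p ⊆ᵇ q) ≡ true
  ⊆⇒⊆ᵇ [] [] _ = refl
  ⊆⇒⊆ᵇ (outside ∷ p) (_ ∷ q) p⊆q = ⊆⇒⊆ᵇ p q (drop-∷-⊆ p⊆q)
  ⊆⇒⊆ᵇ (inside ∷ p) (_ ∷ q) p⊆q with p⊆q here
  ... | here = ⊆⇒⊆ᵇ p q (drop-∷-⊆ p⊆q)

  ∣p∩q∣+∣p∩∁q∣≡∣p∣ : ∀ (p q : Subset n) → ∣ p ∩ q ∣ + ∣ p ∩ ∁ q ∣ ≡ ∣ p ∣
  ∣p∩q∣+∣p∩∁q∣≡∣p∣ [] [] = refl
  ∣p∩q∣+∣p∩∁q∣≡∣p∣ (outside ∷ p) (_ ∷ q) = ∣p∩q∣+∣p∩∁q∣≡∣p∣ p q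
  ∣p∩q∣+∣p∩∁q∣≡∣p∣ (inside ∷ p) (inside ∷ q) = cong suc (∣p∩q∣+∣p∩∁q∣≡∣p∣ p q)
  ∣p∩q∣+∣p∩∁q∣≡∣p∣ (inside ∷ p) (outside ∷ q) =
    trans (+-suc ∣ p ∩ q ∣ ∣ p ∩ ∁ q ∣) (cong suc (∣p∩q∣+∣p∩∁q∣≡∣p∣ p q))

  ∣p∣≤∣q∣⇒∣p∩∁q∣≤∣q∩∁p∣ : ∀ (p q : Subset n) → ∣ p ∣ ≤ ∣ q ∣ →
                          ∣ p ∩ ∁ q ∣ ≤ ∣ q ∩ ∁ p ∣
  ∣p∣≤∣q∣⇒∣p∩∁q∣≤∣q∩∁p∣ p q ∣p∣≤∣q∣ = +-cancelˡ-≤ ∣ p ∩ q ∣ _ _ (begin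
    ∣ p ∩ q ∣ + ∣ p ∩ ∁ q ∣  ≡⟨ ∣p∩q∣+∣p∩∁q∣≡∣p∣ p q ⟩
    ∣ p ∣                    ≤⟨ ∣p∣≤∣q∣ ⟩
    ∣ q ∣                    ≡⟨ ∣p∩q∣+∣p∩∁q∣≡∣p∣ q p ⟨
    ∣ q ∩ p ∣ + ∣ q ∩ ∁ p ∣  ≡⟨ cong (λ r → ∣ r ∣ + ∣ q ∩ ∁ p ∣) (∩-comm q p) ⟩
    ∣ p ∩ q ∣ + ∣ q ∩ ∁ p ∣  ∎)
    where open ≤-Reasoning

  ∣p∪q∣+∣p∩q∣≡∣p∣+∣q∣ : ∀ (p q : Subset n) → ∣ p ∪ q ∣ + ∣ p ∩ q ∣ ≡ ∣ p ∣ + ∣ q ∣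
  ∣p∪q∣+∣p∩q∣≡∣p∣+∣q∣ [] [] = refl
  ∣p∪q∣+∣p∩q∣≡∣p∣+∣q∣ (outside ∷ p) (outside ∷ q) = ∣p∪q∣+∣p∩q∣≡∣p∣+∣q∣ p q
  ∣p∪q∣+∣p∩q∣≡∣p∣+∣q∣ (inside ∷ p) (outside ∷ q) = cong suc (∣p∪q∣+∣p∩q∣≡∣p∣+∣q∣ p q)
  ∣p∪q∣+∣p∩q∣≡∣p∣+∣q∣ (outside ∷ p) (inside ∷ q) =
    trans (cong suc (∣p∪q∣+∣p∩q∣≡∣p∣+∣q∣ p q)) (sym (+-suc ∣ p ∣ ∣ q ∣))
  ∣p∪q∣+∣p∩q∣≡∣p∣+∣q∣ (inside ∷ p) (inside ∷ q) =
    cong suc (trans (+-suc ∣ p ∪ q ∣ ∣ p ∩ q ∣)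
                    (trans (cong suc (∣p∪q∣+∣p∩q∣≡∣p∣+∣q∣ p q)) (sym (+-suc ∣ p ∣ ∣ q ∣))))

  ∣p∪q∣≤∣p∣+∣q∣ : ∀ (p q : Subset n) → ∣ p ∪ q ∣ ≤ ∣ p ∣ + ∣ q ∣
  ∣p∪q∣≤∣p∣+∣q∣ p q = subst (∣ p ∪ q ∣ ≤_) (∣p∪q∣+∣p∩q∣≡∣p∣+∣q∣ p q) (m≤m+n _ _)

  Disjoint : Subset n → Subset n → Set
  Disjoint p q = ∀ {x} → x ∈ p → x ∉ q

  disjoint⇒∣p∩q∣≡0 : ∀ (p q : Subset n) → Disjoint p q → ∣ p ∩ q ∣ ≡ 0
  disjoint⇒∣p∩q∣≡0 {n} p q p#q = trans (cong ∣_∣ p∩q≡⊥) (∣⊥∣≡0 n)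
    where
      p∩q≡⊥ : p ∩ q ≡ ⊥
      p∩q≡⊥ = Empty-unique λ (y , y∈p∩q) → let (y∈p , y∈q) = x∈p∩q⁻ p q y∈p∩q in p#q y∈p y∈q

  disjoint⇒∣p∪q∣≡∣p∣+∣q∣ : ∀ (p q : Subset n) → Disjoint p q → ∣ p ∪ q ∣ ≡ ∣ p ∣ + ∣ q ∣
  disjoint⇒∣p∪q∣≡∣p∣+∣q∣ p q p#q = begin
    ∣ p ∪ q ∣               ≡⟨ sym (+-identityʳ ∣ p ∪ q ∣) ⟩
    ∣ p ∪ q ∣ + 0           ≡⟨ cong (∣ p ∪ q ∣ +_) (sym (disjoint⇒∣p∩q∣≡0 p q p#q)) ⟩
    ∣ p ∪ q ∣ + ∣ p ∩ q ∣   ≡⟨ ∣p∪q∣+∣p∩q∣≡∣p∣+∣q∣ p q ⟩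
    ∣ p ∣ + ∣ q ∣           ∎
    where open ≡-Reasoning

  x∉p⇒∣p∪⁅x⁆∣≡1+∣p∣ : x ∉ p → ∣ p ∪ ⁅ x ⁆ ∣ ≡ suc ∣ p ∣
  x∉p⇒∣p∪⁅x⁆∣≡1+∣p∣ {x = x} {p} x∉p = begin
    ∣ p ∪ ⁅ x ⁆ ∣     ≡⟨ disjoint⇒∣p∪q∣≡∣p∣+∣q∣ p ⁅ x ⁆ p#x ⟩
    ∣ p ∣ + ∣ ⁅ x ⁆ ∣ ≡⟨ cong (∣ p ∣ +_) (∣⁅x⁆∣≡1 x) ⟩
    ∣ p ∣ + 1         ≡⟨ +-comm ∣ p ∣ 1 ⟩
    suc ∣ p ∣         ∎
    where
      open ≡-Reasoning
      p#x : Disjoint p ⁅ x ⁆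
      p#x y∈p y∈⁅x⁆ with x∈⁅y⁆⇒x≡y x y∈⁅x⁆
      ... | refl = x∉p y∈p

  ∪-least : p ⊆ r → q ⊆ r → p ∪ q ⊆ r
  ∪-least {p = p} {q = q} p⊆r q⊆r y∈p∪q with x∈p∪q⁻ p q y∈p∪q
  ... | inj₁ y∈p = p⊆r y∈p
  ... | inj₂ y∈q = q⊆r y∈q

  ∩-greatest : r ⊆ p → r ⊆ q → r ⊆ p ∩ q
  ∩-greatest r⊆p r⊆q y∈r = x∈p∩q⁺ (r⊆p y∈r , r⊆q y∈r)

  ⊆-⋃ : ∀ {A : Set} (f : A → Subset n) {a as} → a ∈ₗ as → f a ⊆ foldr _∪_ ⊥ (map f as)
  ⊆-⋃ f (hereₗ refl) = p⊆p∪q _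
  ⊆-⋃ f {as = b ∷ as} (thereₗ a∈as) = ⊆-trans (⊆-⋃ f a∈as) (q⊆p∪q (f b) _)

  x∈p⇒⁅x⁆⊆p : x ∈ p → ⁅ x ⁆ ⊆ p
  x∈p⇒⁅x⁆⊆p {x = x} x∈p y∈⁅x⁆ with x∈⁅y⁆⇒x≡y x y∈⁅x⁆
  ... | refl = x∈p

  x∈p⇒p∪⁅x⁆≡p : x ∈ p → p ∪ ⁅ x ⁆ ≡ p
  x∈p⇒p∪⁅x⁆≡p x∈p = ⊆-antisym (∪-least ⊆-refl (x∈p⇒⁅x⁆⊆p x∈p)) (p⊆p∪q _)

  ⊆∪⁅x⁆∧x∉⇒⊆ : p ⊆ q ∪ ⁅ x ⁆ → x ∉ p → p ⊆ q
  ⊆∪⁅x⁆∧x∉⇒⊆ {q = q} {x = x} p⊆q∪x x∉p {y} y∈p with x∈p∪q⁻ q ⁅ x ⁆ (p⊆q∪x y∈p)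
  ... | inj₁ y∈q = y∈q
  ... | inj₂ y∈⁅x⁆ with x∈⁅y⁆⇒x≡y x y∈⁅x⁆
  ... | refl = contradiction y∈p x∉p

  ∣p∣<∣q∣⇒∃─ : ∀ (p q : Subset n) → ∣ p ∣ < ∣ q ∣ → ∃ λ x → x ∈ q × x ∉ p
  ∣p∣<∣q∣⇒∃─ (x ∷ p) (outside ∷ q) lt with ∣p∣<∣q∣⇒∃─ p q (≤-<-trans (∣p∣≤∣x∷p∣ x p) lt)
  ... | x , x∈q , x∉p = suc x , there x∈q , x∉p ∘ drop-there
  ∣p∣<∣q∣⇒∃─ (outside ∷ p) (inside ∷ q) lt = zero , here , λ ()
  ∣p∣<∣q∣⇒∃─ (inside ∷ p) (inside ∷ q) (s≤s lt) with ∣p∣<∣q∣⇒∃─ p q lt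
  ... | x , x∈q , x∉p = suc x , there x∈q , x∉p ∘ drop-there

module BoolReflection where

  open import Data.Bool using (Bool; _∧_)
  open import Data.Bool.Properties using (T-≡)
  open import Data.Bool.ListAction using (or)
  open import Data.List using (map)
  open import Data.List.Membership.Propositional using (find; lose) renaming (_∈_ to _∈ₗ_)
  open import Data.List.Relation.Unary.Any.Properties using (any⁺; any⁻)
  open import Data.Product using (∃; _×_; _,_)
  open import Data.Rational using (_<_)
  open import Relation.Nullary.Decidable using (toWitness; fromWitness)
  open import Function using (_⇔_; mk⇔; Equivalence)
  open import Relation.Binary.PropositionalEquality

  ∧-true⁻ : ∀ a {b} → a ∧ b ≡ true → a ≡ true × b ≡ true
  ∧-true⁻ true b≡true = refl , b≡true

  ∧-true⁺ : ∀ {a b} → a ≡ true → b ≡ true → a ∧ b ≡ true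
  ∧-true⁺ refl b≡true = b≡true

  or-map-true⇔ : ∀ {A : Set} {f : A → Bool} {xs} → or (map f xs) ≡ true ⇔ ∃ λ x → x ∈ₗ xs × f x ≡ true
  or-map-true⇔ {f = f} {xs} = mk⇔
    (λ or≡true → let (x , x∈xs , fx) = find (any⁻ f xs (Equivalence.from T-≡ or≡true)) in x , x∈xs , Equivalence.to T-≡ fx)
    (λ (x , x∈xs , fx) → Equivalence.to T-≡ (any⁺ f (lose x∈xs (Equivalence.from T-≡ fx))))

  <ᵇ⇔< : ∀ {p q} → (p <ᵇ q) ≡ true ⇔ p < q
  <ᵇ⇔< = mk⇔ (λ p<ᵇq → toWitness (Equivalence.from T-≡ p<ᵇq)) (λ p<q → Equivalence.to T-≡ (fromWitness p<q))

module MatroidRank {n : ℕ} (M : Matroid n) where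

  open FinSubset
  open import Data.Bool using (Bool; _∧_)
  open import Data.Bool.Properties using (T-≡; T-∧)
  open import Data.Nat using (zero; suc; _+_; _⊔_; _≤_; _<_)
  open import Data.Nat.Properties
  open import Data.Fin.Subset
  open import Data.Fin.Subset.Properties
  open import Data.List using (map; foldr)
  open import Data.Vec using ([]; _∷_)
  open import Data.List using () renaming (_∷_ to _∷ₗ_)
  open import Data.List.Membership.Propositional using () renaming (_∈_ to _∈ₗ_)
  open import Data.List.Membership.Propositional.Properties
  open import Data.List.Relation.Unary.Any using (here; there)
  open import Data.Product using (∃; _×_; _,_)
  open import Data.Sum using (inj₁; inj₂)
  open import Data.Empty using (⊥-elim)
  open import Function using (_∘_; _⇔_; mk⇔; Equivalence)
  open import Relation.Nullary using (¬_; yes; no; contradiction)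
  open import Relation.Nullary.Decidable using (T?)
  open import Relation.Binary.PropositionalEquality

  private variable
    A B I K : Subset n
    x : Fin n

  Independent : Subset n → Set
  Independent A = indep M A ≡ true

  independent-⊆ : A ⊆ B → Independent B → Independent A
  independent-⊆ = indep-⊆ M _ _

  private
    ∈ₗ-allSubsets : ∀ {m} (A : Subset m) → A ∈ₗ allSubsets m
    ∈ₗ-allSubsets {zero} [] = here refl
    ∈ₗ-allSubsets {suc m} (outside ∷ A) = ∈-++⁺ˡ (∈-map⁺ (outside ∷_) (∈ₗ-allSubsets A))
    ∈ₗ-allSubsets {suc m} (inside ∷ A) =
      ∈-++⁺ʳ (map (outside ∷_) (allSubsets m)) (∈-map⁺ (inside ∷_) (∈ₗ-allSubsets A))

    ≤-foldr-⊔ : ∀ {k ks} → k ∈ₗ ks → k ≤ foldr _⊔_ 0 ks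
    ≤-foldr-⊔ {ks = k ∷ₗ ks} (here refl) = m≤m⊔n k (foldr _⊔_ 0 ks)
    ≤-foldr-⊔ {ks = k ∷ₗ ks} (there k∈ks) = ≤-trans (≤-foldr-⊔ k∈ks) (m≤n⊔m k _)

    IndependentSubsetᵇ : Subset n → Subset n → Bool
    IndependentSubsetᵇ A B = (B ⊆ᵇ A) ∧ indep M B

  ∣I∣≤rank : Independent I → I ⊆ A → ∣ I ∣ ≤ rank M A
  ∣I∣≤rank {I} {A} ind I⊆A = ≤-foldr-⊔ (∈-map⁺ ∣_∣ (∈-filter⁺ (T? ∘ IndependentSubsetᵇ A) (∈ₗ-allSubsets I)
    (Equivalence.from T-≡ (trans (cong (_∧ indep M I) (⊆⇒⊆ᵇ I A I⊆A)) ind))))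

  record Basis (A B : Subset n) : Set where
    field
      ⊆A : B ⊆ A
      independent : Independent B
      ∣∣≡rank : ∣ B ∣ ≡ rank M A
  open Basis public

  basis-exists : ∀ A → ∃ (Basis A)
  basis-exists A with foldr-selective ⊔-sel 0 (map ∣_∣ (filterᵇ (IndependentSubsetᵇ A) (allSubsets n)))
  ... | inj₁ rank≡0 = ⊥ , record
    { ⊆A = ⊆-min A ; independent = indep-∅ M ; ∣∣≡rank = trans (∣⊥∣≡0 n) (sym rank≡0) }
  ... | inj₂ rank∈ with ∈-map⁻ ∣_∣ rank∈
  ... | B , B∈ , rank≡∣B∣ with ∈-filter⁻ (T? ∘ IndependentSubsetᵇ A) {xs = allSubsets n} B∈
  ... | _ , t with Equivalence.to T-∧ t
  ... | B⊆ᵇA , indB = B , record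
    { ⊆A = ⊆ᵇ⇒⊆ B A (Equivalence.to T-≡ B⊆ᵇA) ; independent = Equivalence.to T-≡ indB ; ∣∣≡rank = sym rank≡∣B∣ }

  rank-mono : A ⊆ B → rank M A ≤ rank M B
  rank-mono A⊆B with basis-exists _
  ... | K , K-basis = subst (_≤ _) (∣∣≡rank K-basis) (∣I∣≤rank (independent K-basis) (⊆-trans (⊆A K-basis) A⊆B))

  rank-independent : Independent A → rank M A ≡ ∣ A ∣
  rank-independent {A} indA with basis-exists A
  ... | K , K-basis = ≤-antisym
    (subst (_≤ ∣ A ∣) (∣∣≡rank K-basis) (p⊆q⇒∣p∣≤∣q∣ (⊆A K-basis)))
    (∣I∣≤rank indA ⊆-refl)

  extend-to-basis : Independent I → I ⊆ A → ∃ λ B → I ⊆ B × Basis A B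
  extend-to-basis {I} {A} = go (rank M A) (m≤m+n _ _)
    where
      -- k bounds the number of augmentation steps left.
      go : ∀ {I} k → rank M A ≤ k + ∣ I ∣ → Independent I → I ⊆ A → ∃ λ B → I ⊆ B × Basis A B
      go {I} k bound indI I⊆A with ∣ I ∣ <? rank M A
      ... | no ∣I∣≮rank = I , ⊆-refl , record
        { ⊆A = I⊆A ; independent = indI ; ∣∣≡rank = ≤-antisym (∣I∣≤rank indI I⊆A) (≮⇒≥ ∣I∣≮rank) }
      go {I} zero bound indI I⊆A | yes ∣I∣<rank = contradiction bound (<⇒≱ ∣I∣<rank)
      go {I} (suc k) bound indI I⊆A | yes ∣I∣<rank with basis-exists A
      ... | K , K-basis with indep-exch M I K indI (independent K-basis) (subst (∣ I ∣ <_) (sym (∣∣≡rank K-basis)) ∣I∣<rank)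
      ... | x , x∈K , x∉I , indI∪x with go k bound′ indI∪x (∪-least I⊆A (x∈p⇒⁅x⁆⊆p (⊆A K-basis x∈K)))
        where
          bound′ : rank M A ≤ k + ∣ I ∪ ⁅ x ⁆ ∣
          bound′ = subst (λ m → rank M A ≤ k + m) (sym (x∉p⇒∣p∪⁅x⁆∣≡1+∣p∣ x∉I))
                         (subst (rank M A ≤_) (sym (+-suc k ∣ I ∣)) bound)
      ... | B , I∪x⊆B , B-basis = B , ⊆-trans (p⊆p∪q _) I∪x⊆B , B-basis

  rank-subadditive : ∀ X Y → rank M (X ∪ Y) ≤ ∣ X ∣ + rank M Y
  rank-subadditive X Y with basis-exists (X ∪ Y)
  ... | B , B-basis = begin
    rank M (X ∪ Y)     ≡⟨ sym (∣∣≡rank B-basis) ⟩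
    ∣ B ∣              ≤⟨ p⊆q⇒∣p∣≤∣q∣ B⊆X∪[B∩Y] ⟩
    ∣ X ∪ (B ∩ Y) ∣    ≤⟨ ∣p∪q∣≤∣p∣+∣q∣ X (B ∩ Y) ⟩
    ∣ X ∣ + ∣ B ∩ Y ∣  ≤⟨ +-monoʳ-≤ ∣ X ∣ (∣I∣≤rank (independent-⊆ (p∩q⊆p B Y) (independent B-basis)) (p∩q⊆q B Y)) ⟩
    ∣ X ∣ + rank M Y   ∎
    where
      open ≤-Reasoning
      B⊆X∪[B∩Y] : B ⊆ X ∪ (B ∩ Y)
      B⊆X∪[B∩Y] y∈B with x∈p∪q⁻ X Y (⊆A B-basis y∈B)
      ... | inj₁ y∈X = x∈p∪q⁺ (inj₁ y∈X)
      ... | inj₂ y∈Y = x∈p∪q⁺ (inj₂ (x∈p∩q⁺ (y∈B , y∈Y)))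

  rank-∪⁅x⁆≤1+rank : ∀ A x → rank M (A ∪ ⁅ x ⁆) ≤ suc (rank M A)
  rank-∪⁅x⁆≤1+rank A x = begin
    rank M (A ∪ ⁅ x ⁆)        ≡⟨ cong (rank M) (∪-comm A ⁅ x ⁆) ⟩
    rank M (⁅ x ⁆ ∪ A)        ≤⟨ rank-subadditive ⁅ x ⁆ A ⟩
    ∣ ⁅ x ⁆ ∣ + rank M A      ≡⟨ cong (_+ rank M A) (∣⁅x⁆∣≡1 x) ⟩
    suc (rank M A)            ∎
    where open ≤-Reasoning

  Spans : Subset n → Fin n → Set
  Spans A x = rank M (A ∪ ⁅ x ⁆) ≡ rank M A

  ∈-span⇔ : x ∈ span M A ⇔ Spans A x
  ∈-span⇔ {x} {A} = mk⇔
    (λ x∈ → ≡ᵇ⇒≡ _ _ (Equivalence.from T-≡ (Equivalence.to ∈-setOf x∈)))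
    (λ spans → Equivalence.from ∈-setOf (Equivalence.to T-≡ (≡⇒≡ᵇ _ _ spans)))

  ∈⇒spans : x ∈ A → Spans A x
  ∈⇒spans x∈A = cong (rank M) (x∈p⇒p∪⁅x⁆≡p x∈A)

  basis-∪⁅x⁆-independent⇒¬spans : Basis A K → x ∉ K → Independent (K ∪ ⁅ x ⁆) → ¬ Spans A x
  basis-∪⁅x⁆-independent⇒¬spans {A} {K} {x} K-basis x∉K indK∪x A-spans-x = 1+n≰n (begin
    suc (rank M A)         ≡⟨ cong suc (sym (∣∣≡rank K-basis)) ⟩
    suc ∣ K ∣              ≡⟨ sym (x∉p⇒∣p∪⁅x⁆∣≡1+∣p∣ x∉K) ⟩
    ∣ K ∪ ⁅ x ⁆ ∣          ≤⟨ ∣I∣≤rank indK∪x (∪-least (⊆-trans (⊆A K-basis) (p⊆p∪q _)) (q⊆p∪q A ⁅ x ⁆)) ⟩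
    rank M (A ∪ ⁅ x ⁆)     ≡⟨ A-spans-x ⟩
    rank M A               ∎)
    where open ≤-Reasoning

  ¬spans⇒basis-∪⁅x⁆-independent : Basis A K → ¬ Spans A x → Independent (K ∪ ⁅ x ⁆)
  ¬spans⇒basis-∪⁅x⁆-independent {A} {K} {x} K-basis ¬A-spans-x
    with extend-to-basis (independent K-basis) (⊆-trans (⊆A K-basis) (p⊆p∪q ⁅ x ⁆))
  ... | K′ , K⊆K′ , K′-basis with x ∈? K′
  ... | yes x∈K′ = independent-⊆ (∪-least K⊆K′ (x∈p⇒⁅x⁆⊆p x∈K′)) (independent K′-basis)
  ... | no x∉K′ = contradiction (≤-antisym rank[A∪x]≤rank[A] (rank-mono (p⊆p∪q _))) ¬A-spans-x
    where
      rank[A∪x]≤rank[A] : rank M (A ∪ ⁅ x ⁆) ≤ rank M A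
      rank[A∪x]≤rank[A] = subst (_≤ rank M A) (∣∣≡rank K′-basis)
        (∣I∣≤rank (independent K′-basis) (⊆∪⁅x⁆∧x∉⇒⊆ (⊆A K′-basis) x∉K′))

  spans-mono : A ⊆ B → Spans A x → Spans B x
  spans-mono {A} {B} {x} A⊆B A-spans-x with x ∈? B | rank M (B ∪ ⁅ x ⁆) ≟ rank M B
  ... | yes x∈B | _ = ∈⇒spans x∈B
  ... | no _ | yes B-spans-x = B-spans-x
  ... | no x∉B | no ¬B-spans-x with basis-exists A
  ... | K , K-basis with extend-to-basis (independent K-basis) (⊆-trans (⊆A K-basis) A⊆B)
  ... | K′ , K⊆K′ , K′-basis = ⊥-elim (
    basis-∪⁅x⁆-independent⇒¬spans K-basis (x∉B ∘ ⊆A K′-basis ∘ K⊆K′)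
      (independent-⊆ (∪-least (⊆-trans K⊆K′ (p⊆p∪q _)) (q⊆p∪q K′ ⁅ x ⁆))
                     (¬spans⇒basis-∪⁅x⁆-independent K′-basis ¬B-spans-x))
      A-spans-x)

  rank-∪-spanned : (∀ {x} → x ∈ A → Spans B x) → rank M (A ∪ B) ≤ rank M B
  rank-∪-spanned {A} {B} B-spans-A with rank M (A ∪ B) ≤? rank M B
  ... | yes ≤rank = ≤rank
  ... | no ≰rank with basis-exists B
  ... | K , K-basis with extend-to-basis (independent K-basis) (⊆-trans (⊆A K-basis) (q⊆p∪q A B))
  ... | K′ , K⊆K′ , K′-basis
    with ∣p∣<∣q∣⇒∃─ K K′ (subst₂ _<_ (sym (∣∣≡rank K-basis)) (sym (∣∣≡rank K′-basis)) (≰⇒> ≰rank))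
  ... | x , x∈K′ , x∉K = ⊥-elim (
    basis-∪⁅x⁆-independent⇒¬spans K-basis x∉K
      (independent-⊆ (∪-least K⊆K′ (x∈p⇒⁅x⁆⊆p x∈K′)) (independent K′-basis))
      B-spans-x)
    where
      B-spans-x : Spans B x
      B-spans-x with x∈p∪q⁻ A B (⊆A K′-basis x∈K′)
      ... | inj₁ x∈A = B-spans-A x∈A
      ... | inj₂ x∈B = ∈⇒spans x∈B

  -- Q is independent in M / Z and, as Z spans X, spanned there by T.
  ∣independent∣≤∣spanning∣ : ∀ {Q T X Z} → Independent (Q ∪ Z) → Disjoint Q Z →
    (∀ {q} → q ∈ Q → Spans (T ∪ X) q) → (∀ {x} → x ∈ X → Spans Z x) → ∣ Q ∣ ≤ ∣ T ∣
  ∣independent∣≤∣spanning∣ {Q} {T} {X} {Z} indQ∪Z Q#Z T∪X-spans-Q Z-spans-X =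
    +-cancelʳ-≤ (∣ Z ∣) (∣ Q ∣) (∣ T ∣) (begin
    ∣ Q ∣ + ∣ Z ∣          ≡⟨ sym (disjoint⇒∣p∪q∣≡∣p∣+∣q∣ Q Z Q#Z) ⟩
    ∣ Q ∪ Z ∣              ≤⟨ ∣I∣≤rank indQ∪Z (∪-least (p⊆p∪q W) (⊆-trans Z⊆W (q⊆p∪q Q W))) ⟩
    rank M (Q ∪ W)         ≤⟨ rank-∪-spanned (λ q∈Q → spans-mono T∪X⊆W (T∪X-spans-Q q∈Q)) ⟩
    rank M W               ≤⟨ rank-subadditive T (X ∪ Z) ⟩
    ∣ T ∣ + rank M (X ∪ Z) ≤⟨ +-monoʳ-≤ ∣ T ∣ (rank-∪-spanned Z-spans-X) ⟩
    ∣ T ∣ + rank M Z       ≡⟨ cong (∣ T ∣ +_) (rank-independent (independent-⊆ (q⊆p∪q Q Z) indQ∪Z)) ⟩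
    ∣ T ∣ + ∣ Z ∣          ∎)
    where
      open ≤-Reasoning
      W : Subset n
      W = T ∪ (X ∪ Z)
      Z⊆W : Z ⊆ W
      Z⊆W = ⊆-trans (q⊆p∪q X Z) (q⊆p∪q T (X ∪ Z))
      T∪X⊆W : T ∪ X ⊆ W
      T∪X⊆W = ∪-least (p⊆p∪q _) (⊆-trans (p⊆p∪q Z) (q⊆p∪q T (X ∪ Z)))

-- For Bᵢ = B i, Nᵢ = Ngr i and X = X i, step is definitionally Sample.stepᵢ i.
module GreedyInContraction {n : ℕ} (M : Matroid n) (S Bᵢ Nᵢ X : Subset n) (X⊆S : X ⊆ S) where

  open FinSubset
  open BoolReflection
  open MatroidRank M
  open import Data.Bool using (Bool; false; _∧_; if_then_else_)
  open import Data.Bool.Properties using (T-≡)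
  open import Data.Nat using (suc; _+_; _≤_; _≡ᵇ_; s≤s)
  open import Data.Nat.Properties
  open import Data.Fin.Subset
  open import Data.Fin.Subset.Properties
  open import Data.List using ([]; _∷_; foldl)
  open import Data.List.Membership.Propositional using () renaming (_∈_ to _∈ₗ_)
  open import Data.List.Relation.Unary.Any using (here; there)
  open import Data.Product using (_×_; _,_)
  open import Data.Sum using (inj₁; inj₂)
  open import Function using (Equivalence; _∘_)
  open import Relation.Nullary using (yes; no; contradiction)
  open import Relation.Binary.PropositionalEquality

  private variable
    T₀ : Subset n
    e : Fin n

  accepts : Subset n → Fin n → Bool
  accepts T₀ e = not (e ∈ᵇ S) ∧ (e ∈ᵇ Bᵢ) ∧ (e ∈ᵇ Nᵢ) ∧ indepCR M X Nᵢ (T₀ ∪ ⁅ e ⁆)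

  step : Subset n → Fin n → Subset n
  step T₀ e = if accepts T₀ e then T₀ ∪ ⁅ e ⁆ else T₀

  Candidate : Fin n → Set
  Candidate e = e ∉ S × e ∈ Bᵢ × e ∈ Nᵢ

  record Invariant (T₀ : Subset n) : Set where
    field
      ⊆Bᵢ : T₀ ⊆ Bᵢ
      ⊆Nᵢ : T₀ ⊆ Nᵢ
      #S : Disjoint T₀ S
      rank-∪X : rank M (T₀ ∪ X) ≡ rank M X + ∣ T₀ ∣
  open Invariant

  invariant-⊥ : Invariant ⊥
  invariant-⊥ = record
    { ⊆Bᵢ = ⊆-min Bᵢ ; ⊆Nᵢ = ⊆-min Nᵢ ; #S = λ x∈⊥ _ → ∉⊥ x∈⊥
    ; rank-∪X = trans (cong (rank M) (∪-identityˡ X)) (sym (trans (cong (rank M X +_) (∣⊥∣≡0 n)) (+-identityʳ (rank M X)))) }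

  private
    ∪⁅e⁆-#S : Invariant T₀ → e ∉ S → Disjoint (T₀ ∪ ⁅ e ⁆) S
    ∪⁅e⁆-#S {T₀} {e} inv e∉S x∈T∪e x∈S with x∈p∪q⁻ T₀ ⁅ e ⁆ x∈T∪e
    ... | inj₁ x∈T = #S inv x∈T x∈S
    ... | inj₂ x∈⁅e⁆ rewrite x∈⁅y⁆⇒x≡y e x∈⁅e⁆ = e∉S x∈S

    ∪⁅e⁆-#X : Invariant T₀ → e ∉ S → Disjoint (T₀ ∪ ⁅ e ⁆) X
    ∪⁅e⁆-#X inv e∉S x∈T∪e = ∪⁅e⁆-#S inv e∉S x∈T∪e ∘ X⊆S

    ∪⁅e⁆-∪-comm : ∀ (T₀ : Subset n) e → (T₀ ∪ ⁅ e ⁆) ∪ X ≡ (T₀ ∪ X) ∪ ⁅ e ⁆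
    ∪⁅e⁆-∪-comm T₀ e = begin
      (T₀ ∪ ⁅ e ⁆) ∪ X ≡⟨ ∪-assoc T₀ ⁅ e ⁆ X ⟩
      T₀ ∪ (⁅ e ⁆ ∪ X) ≡⟨ cong (T₀ ∪_) (∪-comm ⁅ e ⁆ X) ⟩
      T₀ ∪ (X ∪ ⁅ e ⁆) ≡⟨ ∪-assoc T₀ X ⁅ e ⁆ ⟨
      (T₀ ∪ X) ∪ ⁅ e ⁆ ∎
      where open ≡-Reasoning

  accepted : accepts T₀ e ≡ true → Invariant T₀ → Invariant (T₀ ∪ ⁅ e ⁆)
  accepted {T₀} {e} acc inv with ∧-true⁻ (not (e ∈ᵇ S)) acc
  ... | e∉S , rest with ∧-true⁻ (e ∈ᵇ Bᵢ) rest
  ... | e∈Bᵢ , rest′ with ∧-true⁻ (e ∈ᵇ Nᵢ) rest′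
  ... | e∈Nᵢ , indep-in-contraction with ∧-true⁻ ((T₀ ∪ ⁅ e ⁆) ⊆ᵇ Nᵢ) indep-in-contraction
  ... | _ , rest″ with ∧-true⁻ (∣ (T₀ ∪ ⁅ e ⁆) ∩ X ∣ ≡ᵇ 0) rest″
  ... | _ , rank-eq = record
    { ⊆Bᵢ = ∪-least (⊆Bᵢ inv) (x∈p⇒⁅x⁆⊆p (∈ᵇ⇒∈ e∈Bᵢ))
    ; ⊆Nᵢ = ∪-least (⊆Nᵢ inv) (x∈p⇒⁅x⁆⊆p (∈ᵇ⇒∈ e∈Nᵢ))
    ; #S = ∪⁅e⁆-#S inv (Equivalence.from ∉⇔not-∈ᵇ e∉S)
    ; rank-∪X = ≡ᵇ⇒≡ _ _ (Equivalence.from T-≡ rank-eq) }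

  rejected : accepts T₀ e ≡ false → Invariant T₀ → Candidate e → Spans (T₀ ∪ X) e
  rejected {T₀} {e} rej inv (e∉S , e∈Bᵢ , e∈Nᵢ) with e ∈? T₀
  ... | yes e∈T₀ = ∈⇒spans (x∈p∪q⁺ (inj₁ e∈T₀))
  ... | no e∉T₀ with m≤n⇒m<n∨m≡n (rank-∪⁅x⁆≤1+rank (T₀ ∪ X) e)
  ... | inj₁ (s≤s rank≤) = ≤-antisym rank≤ (rank-mono (p⊆p∪q ⁅ e ⁆))
  ... | inj₂ rank≡ = contradiction (trans (sym accepts≡true) rej) λ ()
    where
      rank-in-contraction : rank M ((T₀ ∪ ⁅ e ⁆) ∪ X) ≡ rank M X + ∣ T₀ ∪ ⁅ e ⁆ ∣
      rank-in-contraction = begin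
        rank M ((T₀ ∪ ⁅ e ⁆) ∪ X)  ≡⟨ cong (rank M) (∪⁅e⁆-∪-comm T₀ e) ⟩
        rank M ((T₀ ∪ X) ∪ ⁅ e ⁆)  ≡⟨ rank≡ ⟩
        suc (rank M (T₀ ∪ X))      ≡⟨ cong suc (rank-∪X inv) ⟩
        suc (rank M X + ∣ T₀ ∣)    ≡⟨ +-suc (rank M X) ∣ T₀ ∣ ⟨
        rank M X + suc ∣ T₀ ∣      ≡⟨ cong (rank M X +_) (x∉p⇒∣p∪⁅x⁆∣≡1+∣p∣ e∉T₀) ⟨
        rank M X + ∣ T₀ ∪ ⁅ e ⁆ ∣  ∎
        where open ≡-Reasoning
      accepts≡true : accepts T₀ e ≡ true
      accepts≡true =
        ∧-true⁺ (Equivalence.to ∉⇔not-∈ᵇ e∉S) (∧-true⁺ (∈⇒∈ᵇ e∈Bᵢ) (∧-true⁺ (∈⇒∈ᵇ e∈Nᵢ)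
          (∧-true⁺ (⊆⇒⊆ᵇ _ _ (∪-least (⊆Nᵢ inv) (x∈p⇒⁅x⁆⊆p e∈Nᵢ)))
          (∧-true⁺ (Equivalence.to T-≡ (≡⇒≡ᵇ _ _ (disjoint⇒∣p∩q∣≡0 _ _ (∪⁅e⁆-#X inv e∉S))))
                   (Equivalence.to T-≡ (≡⇒≡ᵇ _ _ rank-in-contraction))))))

  step-lemma : Invariant T₀ → Invariant (step T₀ e) × T₀ ⊆ step T₀ e × (Candidate e → Spans (step T₀ e ∪ X) e)
  step-lemma {T₀} {e} inv with accepts T₀ e in acc
  ... | true = accepted acc inv , p⊆p∪q ⁅ e ⁆ , λ _ → ∈⇒spans (x∈p∪q⁺ (inj₁ (q⊆p∪q T₀ ⁅ e ⁆ (x∈⁅x⁆ e))))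
  ... | false = inv , ⊆-refl , rejected acc inv

  greedy : ∀ es → Invariant T₀ →
    Invariant (foldl step T₀ es) × T₀ ⊆ foldl step T₀ es ×
    (∀ {e} → e ∈ₗ es → Candidate e → Spans (foldl step T₀ es ∪ X) e)
  greedy [] inv = inv , ⊆-refl , λ ()
  greedy {T₀} (e ∷ es) inv with step-lemma {T₀} {e} inv
  ... | inv′ , T₀⊆step , step-spans-e with greedy es inv′
  ... | invF , step⊆F , F-spans-es = invF , ⊆-trans T₀⊆step step⊆F , λ where
    (here refl) cand → spans-mono (∪-least (⊆-trans step⊆F (p⊆p∪q X)) (q⊆p∪q _ X)) (step-spans-e cand)
    (there e∈es) cand → F-spans-es e∈es cand

module Counting where

  open import Data.Bool using (Bool; false; _∧_; if_then_else_)
  open import Data.Nat using (zero; suc; _+_; _^_)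
  open import Data.Nat.Properties using (+-identityʳ)
  open import Data.Nat.ListAction using (sum)
  open import Data.Fin using (zero; suc)
  open import Data.Fin.Subset using (∣_∣; outside; inside)
  open import Data.Vec using (_∷_) renaming (tabulate to tabulateᵥ)
  open import Data.Vec.Properties using (tabulate∘lookup)
  open import Data.List using ([]; _∷_; _++_; map; tabulate; length)
  open import Data.List.Properties using (filter-++; length-++; length-map; map-cong)
  open import Algebra.Properties.CommutativeSemigroup Data.Nat.Properties.+-commutativeSemigroup using (interchange)
  open import Function using (_∘_; id)
  open import Relation.Binary.PropositionalEquality
  open import Relation.Nullary.Decidable using (T?)

  private variable
    A B : Set

  count-∷ : ∀ (P : A → Bool) x xs → count P (x ∷ xs) ≡ (if P x then 1 else 0) + count P xs
  count-∷ P x xs with P x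
  ... | true = refl
  ... | false = refl

  count-++ : ∀ (P : A → Bool) xs ys → count P (xs ++ ys) ≡ count P xs + count P ys
  count-++ P xs ys = trans (cong length (filter-++ (T? ∘ P) xs ys)) (length-++ (filterᵇ P xs))

  count-map : ∀ (P : B → Bool) (f : A → B) xs → count P (map f xs) ≡ count (P ∘ f) xs
  count-map P f [] = refl
  count-map P f (x ∷ xs) with P (f x)
  ... | true = cong suc (count-map P f xs)
  ... | false = count-map P f xs

  count-filter : ∀ (P Q : A → Bool) xs → count Q (filterᵇ P xs) ≡ count (λ x → P x ∧ Q x) xs
  count-filter P Q [] = refl
  count-filter P Q (x ∷ xs) with P x
  ... | false = count-filter P Q xs
  ... | true with Q x
  ...   | true = cong suc (count-filter P Q xs)
  ...   | false = count-filter P Q xs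

  ∣tabulate∣≡count : ∀ {n} (f : Fin n → A) (P : A → Bool) → ∣ tabulateᵥ (P ∘ f) ∣ ≡ count P (tabulate f)
  ∣tabulate∣≡count {n = zero} f P = refl
  ∣tabulate∣≡count {n = suc n} f P with P (f zero)
  ... | true = cong suc (∣tabulate∣≡count (f ∘ suc) P)
  ... | false = ∣tabulate∣≡count (f ∘ suc) P

  ∣∣≡count : ∀ {n} (A : Subset n) → ∣ A ∣ ≡ count (_∈ᵇ A) (allFin n)
  ∣∣≡count A = trans (cong ∣_∣ (sym (tabulate∘lookup A))) (∣tabulate∣≡count id (_∈ᵇ A))

  sum-map-+ : ∀ (f g : A → ℕ) xs → sum (map (λ x → f x + g x) xs) ≡ sum (map f xs) + sum (map g xs)
  sum-map-+ f g [] = refl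
  sum-map-+ f g (x ∷ xs) =
    trans (cong (f x + g x +_) (sum-map-+ f g xs)) (interchange (f x) (g x) (sum (map f xs)) (sum (map g xs)))

  count≡sum : ∀ (P : A → Bool) xs → count P xs ≡ sum (map (λ x → if P x then 1 else 0) xs)
  count≡sum P [] = refl
  count≡sum P (x ∷ xs) = trans (count-∷ P x xs) (cong ((if P x then 1 else 0) +_) (count≡sum P xs))

  sum-count-swap : ∀ (R : A → B → Bool) xs ys →
    sum (map (λ x → count (R x) ys) xs) ≡ sum (map (λ y → count (λ x → R x y) xs) ys)
  sum-count-swap R [] ys = sym (sum-zeros ys)
    where
      sum-zeros : ∀ ys → sum (map (λ (_ : B) → 0) ys) ≡ 0
      sum-zeros [] = refl
      sum-zeros (_ ∷ ys) = sum-zeros ys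
  sum-count-swap R (x ∷ xs) ys = begin
    count (R x) ys + sum (map (λ x′ → count (R x′) ys) xs)
      ≡⟨ cong₂ _+_ (count≡sum (R x) ys) (sum-count-swap R xs ys) ⟩
    sum (map (λ y → if R x y then 1 else 0) ys) + sum (map (λ y → count (λ x′ → R x′ y) xs) ys)
      ≡⟨ sum-map-+ (λ y → if R x y then 1 else 0) (λ y → count (λ x′ → R x′ y) xs) ys ⟨
    sum (map (λ y → (if R x y then 1 else 0) + count (λ x′ → R x′ y) xs) ys)
      ≡⟨ cong sum (map-cong (λ y → sym (count-∷ (λ x′ → R x′ y) x xs)) ys) ⟩
    sum (map (λ y → count (λ x′ → R x′ y) (x ∷ xs)) ys) ∎
    where open ≡-Reasoning

  length-allSubsets : ∀ m → length (allSubsets m) ≡ 2 ^ m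
  length-allSubsets zero = refl
  length-allSubsets (suc m) = begin
    length (map (outside ∷_) (allSubsets m) ++ map (inside ∷_) (allSubsets m))
      ≡⟨ length-++ (map (outside ∷_) (allSubsets m)) ⟩
    length (map (outside ∷_) (allSubsets m)) + length (map (inside ∷_) (allSubsets m))
      ≡⟨ cong₂ _+_ (length-map _ (allSubsets m)) (length-map _ (allSubsets m)) ⟩
    length (allSubsets m) + length (allSubsets m)
      ≡⟨ cong₂ _+_ (length-allSubsets m) (trans (length-allSubsets m) (sym (+-identityʳ (2 ^ m)))) ⟩
    2 ^ suc m ∎
    where open ≡-Reasoning

  count-∉-allSubsets : ∀ {m} (e : Fin (suc m)) → count (λ S → not (e ∈ᵇ S)) (allSubsets (suc m)) ≡ 2 ^ m
  count-∉-allSubsets {m} e = begin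
    count P (map (outside ∷_) (allSubsets m) ++ map (inside ∷_) (allSubsets m))
      ≡⟨ count-++ P (map (outside ∷_) (allSubsets m)) _ ⟩
    count P (map (outside ∷_) (allSubsets m)) + count P (map (inside ∷_) (allSubsets m))
      ≡⟨ cong₂ _+_ (count-map P (outside ∷_) (allSubsets m)) (count-map P (inside ∷_) (allSubsets m)) ⟩
    count (P ∘ (outside ∷_)) (allSubsets m) + count (P ∘ (inside ∷_)) (allSubsets m)
      ≡⟨ halves e ⟩
    2 ^ m ∎
    where
      open ≡-Reasoning
      P : Subset (suc m) → Bool
      P S = not (e ∈ᵇ S)
      halves : ∀ {m} (e : Fin (suc m)) →
        count (λ S → not (e ∈ᵇ (outside ∷ S))) (allSubsets m) + count (λ S → not (e ∈ᵇ (inside ∷ S))) (allSubsets m) ≡ 2 ^ m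
      halves {m} zero = trans (cong₂ _+_ (count-true (allSubsets m)) (count-false (allSubsets m)))
                              (trans (+-identityʳ _) (length-allSubsets m))
        where
          count-true : ∀ (xs : List (Subset m)) → count (λ _ → true) xs ≡ length xs
          count-true [] = refl
          count-true (_ ∷ xs) = cong suc (count-true xs)
          count-false : ∀ (xs : List (Subset m)) → count (λ _ → false) xs ≡ 0
          count-false [] = refl
          count-false (_ ∷ xs) = count-false xs
      halves {suc m} (suc e) = cong₂ _+_ (count-∉-allSubsets e) (trans (count-∉-allSubsets e) (sym (+-identityʳ (2 ^ m))))

module FilteredSums where

  open import Data.Bool using (Bool; false; _∧_)
  open import Data.Nat using (s≤s⁻¹) renaming (_≤_ to _≤ℕ_)
  open import Data.Nat.Properties using (n≤0⇒n≡0)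
  open import Data.List using ([]; _∷_; map)
  open import Data.List.Membership.Propositional using () renaming (_∈_ to _∈ₗ_)
  open import Data.List.Relation.Unary.Any using (here; there)
  open import Data.Rational using (_+_; _≤_; _<_)
  open import Data.Rational.Properties
  open import Algebra.Bundles using (CommutativeMonoid)
  open import Algebra.Properties.CommutativeSemigroup (CommutativeMonoid.commutativeSemigroup +-0-commutativeMonoid)
    using (x∙yz≈y∙xz)
  open import Relation.Binary.PropositionalEquality

  private variable
    A : Set
    P Q : A → Bool
    w : A → ℚ

  Σ-filter : (A → ℚ) → (A → Bool) → List A → ℚ
  Σ-filter w P xs = sumℚ (map w (filterᵇ P xs))

  Σ-filter-cong : (∀ x → P x ≡ Q x) → ∀ xs → Σ-filter w P xs ≡ Σ-filter w Q xs
  Σ-filter-cong P≗Q [] = refl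
  Σ-filter-cong {P = P} {Q} {w} P≗Q (x ∷ xs) with P x | Q x | P≗Q x
  ... | true | true | _ = cong (w x +_) (Σ-filter-cong P≗Q xs)
  ... | false | false | _ = Σ-filter-cong P≗Q xs

  Σ-filter-split : ∀ (P Q : A → Bool) xs →
    Σ-filter w P xs ≡ Σ-filter w (λ x → P x ∧ Q x) xs + Σ-filter w (λ x → P x ∧ not (Q x)) xs
  Σ-filter-split P Q [] = sym (+-identityˡ 0ℚ)
  Σ-filter-split {w = w} P Q (x ∷ xs) with P x | Q x
  ... | false | _ = Σ-filter-split P Q xs
  ... | true | true = trans (cong (w x +_) (Σ-filter-split P Q xs)) (sym (+-assoc (w x) (Σ-filter w (λ x → P x ∧ Q x) xs) _))
  ... | true | false = trans (cong (w x +_) (Σ-filter-split P Q xs)) (x∙yz≈y∙xz (w x) (Σ-filter w (λ x → P x ∧ Q x) xs) _)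

  Σ-filter-nonneg : (∀ x → 0ℚ ≤ w x) → ∀ (P : A → Bool) xs → 0ℚ ≤ Σ-filter w P xs
  Σ-filter-nonneg w≥0 P [] = ≤-refl
  Σ-filter-nonneg {w = w} w≥0 P (x ∷ xs) with P x
  ... | true = subst (_≤ w x + Σ-filter w P xs) (+-identityˡ 0ℚ) (+-mono-≤ (w≥0 x) (Σ-filter-nonneg w≥0 P xs))
  ... | false = Σ-filter-nonneg w≥0 P xs

  Σ-filter-≥-member : (∀ x → 0ℚ ≤ w x) → ∀ {x xs} → x ∈ₗ xs → P x ≡ true → w x ≤ Σ-filter w P xs
  Σ-filter-≥-member {w = w} {P} w≥0 {x} {x ∷ xs} (here refl) Px rewrite Px =
    subst (_≤ w x + Σ-filter w P xs) (+-identityʳ (w x)) (+-monoʳ-≤ (w x) (Σ-filter-nonneg w≥0 P xs))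
  Σ-filter-≥-member {w = w} {P} w≥0 {x} {y ∷ ys} (there x∈ys) Px with P y
  ... | true = subst (_≤ w y + Σ-filter w P ys) (+-identityˡ (w x)) (+-mono-≤ (w≥0 y) (Σ-filter-≥-member w≥0 x∈ys Px))
  ... | false = Σ-filter-≥-member w≥0 x∈ys Px

  Σ-filter-empty : ∀ (P : A → Bool) xs → count P xs ≡ 0 → Σ-filter w P xs ≡ 0ℚ
  Σ-filter-empty P [] _ = refl
  Σ-filter-empty P (x ∷ xs) none with P x
  ... | false = Σ-filter-empty P xs none

  Σ-filter-<-singleton : ∀ {c} (P : A → Bool) xs → count P xs ≤ℕ 1 → (∀ x → P x ≡ true → w x < c) → 0ℚ < c →
    Σ-filter w P xs < c
  Σ-filter-<-singleton P [] _ _ c>0 = c>0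
  Σ-filter-<-singleton {w = w} P (x ∷ xs) ≤1 w<c c>0 with P x in Px
  ... | true = subst (_< _) (sym (trans (cong (w x +_) (Σ-filter-empty P xs (n≤0⇒n≡0 (s≤s⁻¹ ≤1))))
                                       (+-identityʳ (w x))))
                     (w<c x Px)
  ... | false = Σ-filter-<-singleton P xs ≤1 w<c c>0

module SubsetWeights {n : ℕ} (w : Fin n → ℚ) (w>0 : ∀ e → 0ℚ ℚ.< w e) where

  open FinSubset
  open Counting using (∣∣≡count)
  open FilteredSums
  open import Data.Bool using (_∧_)
  open import Data.Nat using () renaming (_≤_ to _≤ℕ_)
  import Data.Nat.Properties as ℕ
  open import Data.Fin.Subset
  open import Data.Fin.Subset.Properties
  open import Data.List.Membership.Propositional.Properties using (∈-allFin)
  open import Data.Vec.Properties using (lookup-zipWith; lookup-map)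
  open import Data.Rational using (_+_; _≤_; _<_)
  open import Data.Rational.Properties
  open import Data.Product using (_,_)
  open import Relation.Binary.PropositionalEquality

  private variable
    A B : Subset n
    x : Fin n

  private
    w≥0 : ∀ e → 0ℚ ≤ w e
    w≥0 e = <⇒≤ (w>0 e)

  weight-split : ∀ A B → weight w A ≡ weight w (A ∩ B) + weight w (A ∩ ∁ B)
  weight-split A B = begin
    weight w A
      ≡⟨ Σ-filter-split (_∈ᵇ A) (_∈ᵇ B) (allFin n) ⟩
    Σ-filter w (λ e → (e ∈ᵇ A) ∧ (e ∈ᵇ B)) (allFin n) + Σ-filter w (λ e → (e ∈ᵇ A) ∧ not (e ∈ᵇ B)) (allFin n)
      ≡⟨ cong₂ _+_ (Σ-filter-cong (λ e → sym (lookup-zipWith _ e A B)) (allFin n))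
                   (Σ-filter-cong (λ e → trans (cong ((e ∈ᵇ A) ∧_) (sym (lookup-map e not B))) (sym (lookup-zipWith _ e A (∁ B)))) (allFin n)) ⟩
    weight w (A ∩ B) + weight w (A ∩ ∁ B) ∎
    where open ≡-Reasoning

  member-≤-weight : x ∈ A → w x ≤ weight w A
  member-≤-weight {x} x∈A = Σ-filter-≥-member w≥0 (∈-allFin x) (∈⇒∈ᵇ x∈A)

  weight-<-singleton : ∀ {c} → ∣ A ∣ ≤ℕ 1 → (∀ {y} → y ∈ A → w y < c) → 0ℚ < c → weight w A < c
  weight-<-singleton {A} ∣A∣≤1 w<c c>0 =
    Σ-filter-<-singleton (_∈ᵇ A) (allFin n) (subst (_≤ℕ 1) (∣∣≡count A) ∣A∣≤1) (λ y y∈ᵇA → w<c (∈ᵇ⇒∈ y∈ᵇA)) c>0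

  weight-<-exchange : ∣ A ∣ ≤ℕ ∣ B ∣ → B ∩ ∁ A ⊆ ⁅ x ⁆ → x ∈ B → x ∉ A →
    (∀ {y} → y ∈ A → y ∉ B → w y < w x) → weight w A < weight w B
  weight-<-exchange {A} {B} {x} ∣A∣≤∣B∣ B∖A⊆x x∈B x∉A lighter = begin-strict
    weight w A                              ≡⟨ weight-split A B ⟩
    weight w (A ∩ B) + weight w (A ∩ ∁ B)   <⟨ +-monoʳ-< (weight w (A ∩ B)) (weight-<-singleton ∣A∖B∣≤1 lighter′ (w>0 x)) ⟩
    weight w (A ∩ B) + w x                  ≤⟨ +-monoʳ-≤ (weight w (A ∩ B)) (member-≤-weight (x∈p∩q⁺ (x∈B , x∉p⇒x∈∁p x∉A))) ⟩
    weight w (A ∩ B) + weight w (B ∩ ∁ A)   ≡⟨ cong (_+ weight w (B ∩ ∁ A)) (cong (weight w) (∩-comm A B)) ⟩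
    weight w (B ∩ A) + weight w (B ∩ ∁ A)   ≡⟨ weight-split B A ⟨
    weight w B                              ∎
    where
      open ≤-Reasoning
      lighter′ : ∀ {y} → y ∈ A ∩ ∁ B → w y < w x
      lighter′ {y} y∈ with x∈p∩q⁻ A (∁ B) y∈
      ... | y∈A , y∈∁B = lighter y∈A (x∈∁p⇒x∉p y∈∁B)
      ∣A∖B∣≤1 : ∣ A ∩ ∁ B ∣ ≤ℕ 1
      ∣A∖B∣≤1 = ℕ.≤-trans (∣p∣≤∣q∣⇒∣p∩∁q∣≤∣q∩∁p∣ A B ∣A∣≤∣B∣) (ℕ.≤-trans (p⊆q⇒∣p∣≤∣q∣ B∖A⊆x) (ℕ.≤-reflexive (∣⁅x⁆∣≡1 x)))

module MaximumWeightIndependentSet {n : ℕ} (M : Matroid n) (w : Fin n → ℚ) (w>0 : ∀ e → 0ℚ ℚ.< w e)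
  (OPT : Subset n) (OPT-independent : indep M OPT ≡ true)
  (OPT-maximum : ∀ I → indep M I ≡ true → weight w I ℚ.≤ weight w OPT) where

  open FinSubset
  open BoolReflection
  open MatroidRank M
  open SubsetWeights w w>0
  open import Data.Bool using (_∧_)
  open import Data.Nat using (_≟_) renaming (_≤_ to _≤ℕ_)
  open import Data.Fin.Subset
  open import Data.Fin.Subset.Properties
  open import Data.Rational using (_≤_; _<_)
  open import Data.Rational.Properties using (<-irrefl; <-≤-trans; ≤-<-trans; ≮⇒≥)
  open import Data.Product using (_,_; proj₁; proj₂)
  open import Data.Sum using (inj₁; inj₂)
  open import Data.Empty using (⊥-elim)
  open import Function using (Equivalence; _∘_)
  open import Relation.Nullary using (yes; no; contradiction)
  open import Relation.Binary.PropositionalEquality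

  heavyPart : ℚ → Subset n
  heavyPart t = setOf (λ e → (e ∈ᵇ OPT) ∧ (t <ᵇ w e))

  heavyPart⊆OPT : ∀ t → heavyPart t ⊆ OPT
  heavyPart⊆OPT t e∈ = ∈ᵇ⇒∈ (proj₁ (∧-true⁻ _ (Equivalence.to ∈-setOf e∈)))

  ∈-heavyPart : ∀ {t e} → e ∈ OPT → t < w e → e ∈ heavyPart t
  ∈-heavyPart e∈OPT t<we = Equivalence.from ∈-setOf (∧-true⁺ (∈⇒∈ᵇ e∈OPT) (Equivalence.from <ᵇ⇔< t<we))

  heavyPart-heavy : ∀ {t e} → e ∈ heavyPart t → t < w e
  heavyPart-heavy e∈ = Equivalence.to <ᵇ⇔< (proj₂ (∧-true⁻ _ (Equivalence.to ∈-setOf e∈)))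

  heavyPart-basis : ∀ t → Basis (heavyPart t) (heavyPart t)
  heavyPart-basis t = record
    { ⊆A = ⊆-refl ; independent = Z-indep ; ∣∣≡rank = sym (rank-independent Z-indep) }
    where
      Z-indep : Independent (heavyPart t)
      Z-indep = independent-⊆ (heavyPart⊆OPT t) OPT-independent

  -- If Z did not span x, Z ∪ ⁅ x ⁆ would extend to a basis B of OPT ∪ ⁅ x ⁆ trading at most one
  -- light element of OPT for the heavier x, so B would outweigh OPT.
  heavyPart-spans-heavier : ∀ {t x} → t < w x → Spans (heavyPart t) x
  heavyPart-spans-heavier {t} {x} t<wx with rank M (heavyPart t ∪ ⁅ x ⁆) ≟ rank M (heavyPart t)
  ... | yes Z-spans-x = Z-spans-x
  ... | no ¬Z-spans-x
    with extend-to-basis (¬spans⇒basis-∪⁅x⁆-independent (heavyPart-basis t) ¬Z-spans-x)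
                         (∪-least (⊆-trans (heavyPart⊆OPT t) (p⊆p∪q ⁅ x ⁆)) (q⊆p∪q OPT ⁅ x ⁆))
  ... | B , Z∪x⊆B , B-basis =
    ⊥-elim (<-irrefl refl (<-≤-trans (weight-<-exchange ∣OPT∣≤∣B∣ B∖OPT⊆x x∈B x∉OPT lighter) (OPT-maximum B (independent B-basis))))
    where
      x∉OPT : x ∉ OPT
      x∉OPT x∈OPT = ¬Z-spans-x (∈⇒spans (∈-heavyPart x∈OPT t<wx))
      x∈B : x ∈ B
      x∈B = Z∪x⊆B (q⊆p∪q (heavyPart t) ⁅ x ⁆ (x∈⁅x⁆ x))
      ∣OPT∣≤∣B∣ : ∣ OPT ∣ ≤ℕ ∣ B ∣
      ∣OPT∣≤∣B∣ = subst (∣ OPT ∣ ≤ℕ_) (sym (∣∣≡rank B-basis)) (∣I∣≤rank OPT-independent (p⊆p∪q ⁅ x ⁆))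
      B∖OPT⊆x : B ∩ ∁ OPT ⊆ ⁅ x ⁆
      B∖OPT⊆x y∈ with x∈p∩q⁻ B (∁ OPT) y∈
      ... | y∈B , y∈∁OPT with x∈p∪q⁻ OPT ⁅ x ⁆ (⊆A B-basis y∈B)
      ...   | inj₁ y∈OPT = contradiction y∈OPT (x∈∁p⇒x∉p y∈∁OPT)
      ...   | inj₂ y∈⁅x⁆ = y∈⁅x⁆
      lighter : ∀ {y} → y ∈ OPT → y ∉ B → w y < w x
      lighter {y} y∈OPT y∉B = ≤-<-trans (≮⇒≥ (y∉B ∘ Z∪x⊆B ∘ p⊆p∪q ⁅ x ⁆ ∘ ∈-heavyPart y∈OPT)) t<wx

module RationalArithmetic where

  open import Data.Nat as ℕ using (suc; _^_) renaming (_+_ to _+ℕ_; _*_ to _*ℕ_; _≤_ to _≤ℕ_)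
  import Data.Nat.Properties as ℕ
  open import Data.Nat.ListAction using (sum)
  import Data.Integer as ℤ
  import Data.Integer.Properties as ℤ
  open import Data.List using ([]; _∷_; map)
  open import Data.Rational using (1ℚ; ½; _+_; _*_; _≤_; nonNegative; fromℚᵘ)
    renaming (_/_ to _/ℚ_)
  open import Data.Rational.Properties
  open import Data.Rational.Unnormalised using (mkℚᵘ; *≡*) renaming (_+_ to _+ᵘ_; _*_ to _*ᵘ_)
  import Data.Rational.Unnormalised.Properties as ℚᵘ
  open import Algebra.Bundles using (CommutativeMonoid)
  open import Algebra.Properties.CommutativeSemigroup (CommutativeMonoid.commutativeSemigroup *-1-commutativeMonoid)
    using (interchange)
  open import Data.Product using (_,_)
  open import Function using (_∘_)
  open import Relation.Binary.PropositionalEquality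

  fromℚᵘ-homo-+ : ∀ p q → fromℚᵘ (p +ᵘ q) ≡ fromℚᵘ p + fromℚᵘ q
  fromℚᵘ-homo-+ p q = toℚᵘ-injective (ℚᵘ.≃-trans (toℚᵘ-fromℚᵘ (p +ᵘ q))
    (ℚᵘ.≃-sym (ℚᵘ.≃-trans (toℚᵘ-homo-+ (fromℚᵘ p) (fromℚᵘ q)) (ℚᵘ.+-cong (toℚᵘ-fromℚᵘ p) (toℚᵘ-fromℚᵘ q)))))

  fromℚᵘ-homo-* : ∀ p q → fromℚᵘ (p *ᵘ q) ≡ fromℚᵘ p * fromℚᵘ q
  fromℚᵘ-homo-* p q = toℚᵘ-injective (ℚᵘ.≃-trans (toℚᵘ-fromℚᵘ (p *ᵘ q))
    (ℚᵘ.≃-sym (ℚᵘ.≃-trans (toℚᵘ-homo-* (fromℚᵘ p) (fromℚᵘ q)) (ℚᵘ.*-cong (toℚᵘ-fromℚᵘ p) (toℚᵘ-fromℚᵘ q)))))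

  toℚ-+ : ∀ a b → toℚ (a +ℕ b) ≡ toℚ a + toℚ b
  toℚ-+ a b = trans (fromℚᵘ-cong {mkℚᵘ (ℤ.+ (a +ℕ b)) 0} {mkℚᵘ (ℤ.+ a) 0 +ᵘ mkℚᵘ (ℤ.+ b) 0} (*≡* integral))
                    (fromℚᵘ-homo-+ (mkℚᵘ (ℤ.+ a) 0) (mkℚᵘ (ℤ.+ b) 0))
    where
      integral : ℤ.+ (a +ℕ b) ℤ.* ℤ.+ 1 ≡ (ℤ.+ a ℤ.* ℤ.+ 1 ℤ.+ ℤ.+ b ℤ.* ℤ.+ 1) ℤ.* ℤ.+ 1
      integral = trans (ℤ.*-identityʳ _) (sym (trans (ℤ.*-identityʳ _)
                   (trans (cong₂ ℤ._+_ (ℤ.*-identityʳ (ℤ.+ a)) (ℤ.*-identityʳ (ℤ.+ b))) (sym (ℤ.pos-+ a b)))))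

  toℚ-* : ∀ a b → toℚ (a *ℕ b) ≡ toℚ a * toℚ b
  toℚ-* a b = trans (fromℚᵘ-cong {mkℚᵘ (ℤ.+ (a *ℕ b)) 0} {mkℚᵘ (ℤ.+ a) 0 *ᵘ mkℚᵘ (ℤ.+ b) 0}
                                 (*≡* (cong (ℤ._* ℤ.+ 1) (ℤ.pos-* a b))))
                    (fromℚᵘ-homo-* (mkℚᵘ (ℤ.+ a) 0) (mkℚᵘ (ℤ.+ b) 0))

  toℚ-mono-≤ : ∀ {a b} → a ≤ℕ b → toℚ a ≤ toℚ b
  toℚ-mono-≤ {a} a≤b with ℕ.m≤n⇒∃[o]m+o≡n a≤b
  ... | o , refl = subst₂ _≤_ (+-identityʳ (toℚ a)) (sym (toℚ-+ a o))
                     (+-monoʳ-≤ (toℚ a) (nonNegative⁻¹ (toℚ o) {{normalize-nonNeg o 1}}))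

  halfPow-*-2^ : ∀ m → halfPow m * toℚ (2 ^ m) ≡ 1ℚ
  halfPow-*-2^ ℕ.zero = refl
  halfPow-*-2^ (suc m) = begin
    (½ * halfPow m) * toℚ (2 *ℕ 2 ^ m)       ≡⟨ cong ((½ * halfPow m) *_) (toℚ-* 2 (2 ^ m)) ⟩
    (½ * halfPow m) * (toℚ 2 * toℚ (2 ^ m))  ≡⟨ interchange ½ (halfPow m) (toℚ 2) (toℚ (2 ^ m)) ⟩
    (½ * toℚ 2) * (halfPow m * toℚ (2 ^ m))  ≡⟨ cong (1ℚ *_) (halfPow-*-2^ m) ⟩
    1ℚ                                        ∎
    where open ≡-Reasoning

  /2^≡*halfPow : ∀ c d m → suc d ≡ 2 ^ m → (ℤ.+ c) /ℚ suc d ≡ toℚ c * halfPow m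
  /2^≡*halfPow c d m 1+d≡2^m = begin
    q                                  ≡⟨ *-identityʳ q ⟨
    q * 1ℚ                             ≡⟨ cong (q *_) (halfPow-*-2^ m) ⟨
    q * (halfPow m * toℚ (2 ^ m))      ≡⟨ cong (λ k → q * (halfPow m * toℚ k)) 1+d≡2^m ⟨
    q * (halfPow m * toℚ (suc d))      ≡⟨ cong (q *_) (*-comm (halfPow m) (toℚ (suc d))) ⟩
    q * (toℚ (suc d) * halfPow m)      ≡⟨ *-assoc q (toℚ (suc d)) (halfPow m) ⟨
    (q * toℚ (suc d)) * halfPow m      ≡⟨ cong (_* halfPow m) q*[1+d]≡c ⟩
    toℚ c * halfPow m                  ∎
    where
      open ≡-Reasoning
      q : ℚ
      q = (ℤ.+ c) /ℚ suc d
      q*[1+d]≡c : q * toℚ (suc d) ≡ toℚ c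
      q*[1+d]≡c = trans (sym (fromℚᵘ-homo-* (mkℚᵘ (ℤ.+ c) d) (mkℚᵘ (ℤ.+ suc d) 0)))
        (fromℚᵘ-cong {mkℚᵘ (ℤ.+ c) d *ᵘ mkℚᵘ (ℤ.+ suc d) 0} {mkℚᵘ (ℤ.+ c) 0}
          (*≡* (trans (ℤ.*-identityʳ _) (cong (λ k → ℤ.+ c ℤ.* ℤ.+ k) (sym (ℕ.*-identityʳ (suc d)))))))

  private variable
    A : Set

  sumℚ-toℚ : ∀ (f : A → ℕ) xs → sumℚ (map (toℚ ∘ f) xs) ≡ toℚ (sum (map f xs))
  sumℚ-toℚ f [] = refl
  sumℚ-toℚ f (x ∷ xs) = trans (cong (toℚ (f x) +_) (sumℚ-toℚ f xs)) (sym (toℚ-+ (f x) (sum (map f xs))))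

  sumℚ-*ʳ : ∀ (f : A → ℚ) k xs → sumℚ (map (λ x → f x * k) xs) ≡ sumℚ (map f xs) * k
  sumℚ-*ʳ f k [] = sym (*-zeroˡ k)
  sumℚ-*ʳ f k (x ∷ xs) = trans (cong (f x * k +_) (sumℚ-*ʳ f k xs)) (sym (*-distribʳ-+ k (f x) (sumℚ (map f xs))))

  sumℚ-mono-≤ : ∀ {f g : A → ℚ} → (∀ x → f x ≤ g x) → ∀ xs → sumℚ (map f xs) ≤ sumℚ (map g xs)
  sumℚ-mono-≤ f≤g [] = ≤-refl
  sumℚ-mono-≤ f≤g (x ∷ xs) = +-mono-≤ (f≤g x) (sumℚ-mono-≤ f≤g xs)

  halfPow-nonNeg : ∀ m → 0ℚ ≤ halfPow m
  halfPow-nonNeg ℕ.zero = ≤ᵇ⇒≤ _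
  halfPow-nonNeg (suc m) = subst (_≤ ½ * halfPow m) (*-zeroʳ ½) (*-monoˡ-≤-nonNeg ½ (halfPow-nonNeg m))

  halfPow-antitone : ∀ {a b} → a ≤ℕ b → halfPow b ≤ halfPow a
  halfPow-antitone {a} a≤b with ℕ.m≤n⇒∃[o]m+o≡n a≤b
  ... | o , refl = go a o
    where
      halving : ∀ m → halfPow (suc m) ≤ halfPow m
      halving m = subst (½ * halfPow m ≤_) (*-identityˡ (halfPow m))
        (*-monoʳ-≤-nonNeg (halfPow m) {{nonNegative (halfPow-nonNeg m)}} {½} {1ℚ} (≤ᵇ⇒≤ _))
      go : ∀ a o → halfPow (a +ℕ o) ≤ halfPow a
      go a ℕ.zero = ≤-reflexive (cong halfPow (ℕ.+-identityʳ a))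
      go a (suc o) = ≤-trans (≤-reflexive (cong halfPow (ℕ.+-suc a o))) (≤-trans (halving (a +ℕ o)) (go a o))

module UniformSampling where

  open Counting using (count-∉-allSubsets)
  open RationalArithmetic using (/2^≡*halfPow)
  open import Data.Bool using (Bool; _∧_)
  open import Data.Nat using (zero; suc; _^_; _<_)
  open import Data.Nat.Properties using (m^n>0; <-irrefl)
  open import Data.Empty using (⊥-elim)
  import Data.Integer as ℤ
  open import Data.Rational using (½; _*_) renaming (_/_ to _/ℚ_)
  open import Data.Rational.Properties using (*-assoc; *-comm)
  open import Relation.Binary.PropositionalEquality

  condProb-≡ : ∀ {n} (A B : Subset n → Bool) {d} → count B (allSubsets n) ≡ suc d →
    condProb A B ≡ (ℤ.+ count (λ S → A S ∧ B S) (allSubsets n)) /ℚ suc d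
  condProb-≡ {n} A B eq with count B (allSubsets n)
  condProb-≡ A B refl | _ = refl

  condProb-∉-*½ : ∀ {n} (A : Subset n → Bool) (e : Fin n) →
    condProb A (λ S → not (e ∈ᵇ S)) * ½ ≡ toℚ (count (λ S → A S ∧ not (e ∈ᵇ S)) (allSubsets n)) * halfPow n
  condProb-∉-*½ {suc m} A e with 2 ^ m in 2^m≡ | count-∉-allSubsets e
  ... | zero | _ = ⊥-elim (<-irrefl refl (subst (0 <_) 2^m≡ (m^n>0 2 m)))
  ... | suc d | count≡ = begin
    condProb A (λ S → not (e ∈ᵇ S)) * ½    ≡⟨ cong (_* ½) (condProb-≡ A _ count≡) ⟩
    ((ℤ.+ c) /ℚ suc d) * ½                  ≡⟨ cong (_* ½) (/2^≡*halfPow c d m (sym 2^m≡)) ⟩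
    (toℚ c * halfPow m) * ½                 ≡⟨ *-assoc (toℚ c) (halfPow m) ½ ⟩
    toℚ c * (halfPow m * ½)                 ≡⟨ cong (toℚ c *_) (*-comm (halfPow m) ½) ⟩
    toℚ c * halfPow (suc m)                 ∎
    where
      open ≡-Reasoning
      c : ℕ
      c = count (λ S → A S ∧ not (e ∈ᵇ S)) (allSubsets (suc m))

module SingletonBuckets (h : ℕ) (W : ℚ) {n : ℕ} (w : Fin n → ℚ) (W>0 : 0ℚ ℚ.< W) where

  open Classes h W w
  open Bucketing 0 0
  open FinSubset
  open BoolReflection
  open RationalArithmetic using (halfPow-antitone)
  open import Data.Bool.Properties using (T-≡)
  open import Data.Nat as ℕ using (zero; suc; _∸_; _≤_; _<_; s≤s; s≤s⁻¹) renaming (_+_ to _+ℕ_)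
  open import Data.Nat.Properties
  open import Data.List using (upTo)
  open import Data.List.Membership.Propositional using () renaming (_∈_ to _∈ₗ_)
  open import Data.List.Membership.Propositional.Properties using (∈-filter⁺; ∈-filter⁻; ∈-upTo⁺; ∈-upTo⁻)
  open import Data.Fin.Subset using (_∈_)
  open import Data.Rational using (_*_) renaming (_≤_ to _≤ℚ_; _<_ to _<ℚ_)
  import Data.Rational.Properties as ℚ
  open import Data.Product using (_×_; _,_; proj₁)
  open import Function using (_⇔_; mk⇔; Equivalence; _∘_)
  open import Relation.Nullary.Decidable using (T?)
  open import Relation.Binary.PropositionalEquality

  ∈-range⇔ : ∀ {a b j} → j ∈ₗ range a b ⇔ (a ≤ j × j ≤ b)
  ∈-range⇔ {a} {b} {j} = mk⇔
    (λ j∈ → let (j∈upTo , a≤ᵇj) = ∈-filter⁻ (T? ∘ (a ℕ.≤ᵇ_)) {xs = upTo (suc b)} j∈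
            in ≤ᵇ⇒≤ a j a≤ᵇj , s≤s⁻¹ (∈-upTo⁻ j∈upTo))
    (λ (a≤j , j≤b) → ∈-filter⁺ (T? ∘ (a ℕ.≤ᵇ_)) (∈-upTo⁺ (s≤s j≤b)) (≤⇒≤ᵇ a≤j))

  threshold : ℕ → ℚ
  threshold i = W * halfPow (h ∸ i)

  record InClass (j : ℕ) (e : Fin n) : Set where
    field
      1≤j : 1 ≤ j
      j≤h : j ≤ h
      above : W * halfPow (h ∸ j +ℕ 1) <ℚ w e
      below : w e ≤ℚ threshold j

  inC⇒InClass : ∀ {j e} → inC j e ≡ true → InClass j e
  inC⇒InClass {j} {e} inC≡ with ∧-true⁻ (1 ℕ.≤ᵇ j) inC≡
  ... | 1≤ᵇj , rest with ∧-true⁻ (j ℕ.≤ᵇ h) rest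
  ... | j≤ᵇh , rest′ with ∧-true⁻ ((W * halfPow (h ∸ j +ℕ 1)) <ᵇ w e) rest′
  ... | above , below = record
    { 1≤j = ≤ᵇ⇒≤ 1 j (Equivalence.from T-≡ 1≤ᵇj)
    ; j≤h = ≤ᵇ⇒≤ j h (Equivalence.from T-≡ j≤ᵇh)
    ; above = Equivalence.to <ᵇ⇔< above
    ; below = ℚ.≤ᵇ⇒≤ (Equivalence.from T-≡ below) }

  inB⇔inC : ∀ {k e} → inB (suc k) e ≡ true ⇔ inC (suc k) e ≡ true
  inB⇔inC {k} {e} = mk⇔ to from
    where
      lower : 1 ℕ.* k +ℕ 1 ≡ suc k
      lower = trans (cong (_+ℕ 1) (*-identityˡ k)) (+-comm k 1)
      upper : 1 ℕ.* suc k ≡ suc k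
      upper = *-identityˡ (suc k)
      to : inB (suc k) e ≡ true → inC (suc k) e ≡ true
      to inB≡ with Equivalence.to (or-map-true⇔ {xs = range 1 h}) inB≡
      ... | j , _ , conj with ∧-true⁻ (1 ℕ.* k +ℕ 1 ℕ.≤ᵇ j +ℕ 0) conj
      ... | k<ᵇj , rest with ∧-true⁻ (j +ℕ 0 ℕ.≤ᵇ 1 ℕ.* suc k) rest
      ... | j≤ᵇk , inC≡ = subst (λ i → inC i e ≡ true) j≡1+k inC≡
        where
          j≡1+k : j ≡ suc k
          j≡1+k = ≤-antisym
            (subst₂ _≤_ (+-identityʳ j) upper (≤ᵇ⇒≤ _ _ (Equivalence.from T-≡ j≤ᵇk)))
            (subst₂ _≤_ lower (+-identityʳ j) (≤ᵇ⇒≤ _ _ (Equivalence.from T-≡ k<ᵇj)))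
      from : inC (suc k) e ≡ true → inB (suc k) e ≡ true
      from inC≡ = Equivalence.from (or-map-true⇔ {xs = range 1 h})
        ( suc k
        , Equivalence.from ∈-range⇔ (InClass.1≤j c , InClass.j≤h c)
        , ∧-true⁺ (bound (subst₂ _≤_ (sym lower) (sym (+-identityʳ (suc k))) ≤-refl))
            (∧-true⁺ (bound (subst₂ _≤_ (sym (+-identityʳ (suc k))) (sym upper) ≤-refl)) inC≡))
        where
          c : InClass (suc k) e
          c = inC⇒InClass inC≡
          bound : ∀ {a b} → a ≤ b → (a ℕ.≤ᵇ b) ≡ true
          bound = Equivalence.to T-≡ ∘ ≤⇒≤ᵇ

  C⇔B : ∀ {k e} → e ∈ C (suc k) ⇔ e ∈ B (suc k)
  C⇔B = mk⇔ (Equivalence.from ∈-setOf ∘ Equivalence.from inB⇔inC ∘ Equivalence.to ∈-setOf)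
            (Equivalence.from ∈-setOf ∘ Equivalence.to inB⇔inC ∘ Equivalence.to ∈-setOf)

  C-light : ∀ {i e} → e ∈ C i → w e ≤ℚ threshold i
  C-light {i} {e} = InClass.below ∘ inC⇒InClass {i} {e} ∘ Equivalence.to ∈-setOf

  C≥⊆B≥ : ∀ {i k} → suc k ≤ i → C≥ i ⊆ B≥ (suc k)
  C≥⊆B≥ {i} {k} k<i {e} e∈C≥ with Equivalence.to (or-map-true⇔ {xs = range i h}) (Equivalence.to ∈-setOf e∈C≥)
  ... | zero , _ , inC≡ with () ← InClass.1≤j (inC⇒InClass {0} {e} inC≡)
  ... | suc j , j∈range , inC≡ = Equivalence.from ∈-setOf (Equivalence.from (or-map-true⇔ {xs = range (suc k) (h +ℕ 0)})
    ( suc j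
    , Equivalence.from ∈-range⇔ ( ≤-trans k<i (proj₁ (Equivalence.to (∈-range⇔ {i} {h}) j∈range))
                                , ≤-trans (InClass.j≤h (inC⇒InClass inC≡)) (m≤m+n h 0))
    , Equivalence.from inB⇔inC inC≡))

  B≥-heavy : ∀ {i e} → e ∈ B≥ (suc i) → threshold i <ℚ w e
  B≥-heavy {i} {e} e∈B≥ with Equivalence.to (or-map-true⇔ {xs = range (suc i) (h +ℕ 0)}) (Equivalence.to ∈-setOf e∈B≥)
  ... | zero , j∈range , _ with () ← proj₁ (Equivalence.to (∈-range⇔ {suc i} {h +ℕ 0}) j∈range)
  ... | suc k , k∈range , inB≡ = ℚ.≤-<-trans (ℚ.*-monoˡ-≤-nonNeg W {{ℚ.nonNegative (ℚ.<⇒≤ W>0)}} (halfPow-antitone exponent≤))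
                                              (InClass.above c)
    where
      c : InClass (suc k) e
      c = inC⇒InClass (Equivalence.to inB⇔inC inB≡)
      exponent≤ : h ∸ suc k +ℕ 1 ≤ h ∸ i
      exponent≤ = begin
        h ∸ suc k +ℕ 1  ≡⟨ +-comm (h ∸ suc k) 1 ⟩
        suc (h ∸ suc k) ≡⟨ +-∸-assoc 1 (InClass.j≤h c) ⟨
        h ∸ k           ≤⟨ ∸-monoʳ-≤ h (s≤s⁻¹ (proj₁ (Equivalence.to (∈-range⇔ {suc i} {h +ℕ 0}) k∈range))) ⟩
        h ∸ i           ∎
        where open ≤-Reasoning

module ParityFilters where

  open import Data.Bool using (Bool; false; T)
  open import Data.Nat using (zero; suc)
  open import Data.List.Membership.Propositional using () renaming (_∈_ to _∈ₗ_)
  open import Data.List.Membership.Propositional.Properties using (∈-filter⁺)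
  open import Data.Sum using (_⊎_; inj₁; inj₂)
  open import Function using (_∘_)
  open import Relation.Nullary.Decidable using (T?)
  open import Relation.Binary.PropositionalEquality

  2-periodic-≗ : ∀ (f g : ℕ → Bool) → f 0 ≡ g 0 → f 1 ≡ g 1 →
    (∀ k → f (suc (suc k)) ≡ f k) → (∀ k → g (suc (suc k)) ≡ g k) → ∀ k → f k ≡ g k
  2-periodic-≗ f g f0 f1 f-periodic g-periodic zero = f0
  2-periodic-≗ f g f0 f1 f-periodic g-periodic (suc zero) = f1
  2-periodic-≗ f g f0 f1 f-periodic g-periodic (suc (suc k)) =
    trans (f-periodic k) (trans (2-periodic-≗ f g f0 f1 f-periodic g-periodic k) (sym (g-periodic k)))

  ∈-filter-not⊎∈-filter : ∀ (f g : ℕ → Bool) → (∀ k → f k ≡ g k) → ∀ {k ks} → k ∈ₗ ks →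
    k ∈ₗ filterᵇ (not ∘ f) ks ⊎ k ∈ₗ filterᵇ g ks
  ∈-filter-not⊎∈-filter f g f≗g {k} k∈ks with f k in fk
  ... | false = inj₁ (∈-filter⁺ (T? ∘ not ∘ f) k∈ks (subst (λ b → T (not b)) (sym fk) _))
  ... | true = inj₂ (∈-filter⁺ (T? ∘ g) k∈ks (subst T (trans (sym fk) (f≗g k)) _))

module ExpectationBound {n : ℕ} (M : Matroid n) (w : Fin n → ℚ) (W : ℚ) (h : ℕ) (OPT : Subset n)
  (order : Subset n → List (Fin n)) (k : ℕ)
  (w>0 : ∀ e → 0ℚ ℚ.< w e) (W>0 : 0ℚ ℚ.< W)
  (OPT-independent : indep M OPT ≡ true) (OPT-maximum : ∀ I → indep M I ≡ true → weight w I ℚ.≤ weight w OPT)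
  (order-reveals : ∀ S → order S ↭ filterᵇ (λ e → not (e ∈ᵇ S)) (allFin n))
  (1+k≤h : ℕ.suc k ℕ.≤ h) where

  open Classes h W w
  open Bucketing 0 0
  open FinSubset
  open BoolReflection
  open MatroidRank M
  open MaximumWeightIndependentSet M w w>0 OPT OPT-independent OPT-maximum
  open SingletonBuckets h W w W>0
  open ParityFilters
  open import Data.Bool using (Bool; false; _∧_)
  open import Data.Bool.Properties using (T-≡)
  open import Data.Nat using (zero; suc) renaming (_≤_ to _≤ℕ_; _+_ to _+ℕ_)
  open import Data.Nat.Properties using (≤-trans; n≤1+n; m≤m+n; m≤n+m)
  open import Data.Fin.Subset
  open import Data.Fin.Subset.Properties
  open import Data.List using (map)
  open import Data.List.Membership.Propositional using () renaming (_∈_ to _∈ₗ_)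
  open import Data.List.Membership.Propositional.Properties using (∈-filter⁺; ∈-allFin)
  open import Data.List.Relation.Binary.Permutation.Propositional using (↭-sym)
  open import Data.List.Relation.Binary.Permutation.Propositional.Properties using (∈-resp-↭)
  open import Data.Product using (_,_; proj₁; proj₂)
  open import Data.Sum using (_⊎_; inj₁; inj₂)
  open import Function using (_∘_; Equivalence)
  open import Relation.Nullary.Decidable using (T?)
  import Data.Rational.Properties as ℚ
  open import Relation.Binary.PropositionalEquality

  i : ℕ
  i = suc k

  spannedBySample : Fin n → Subset n → Bool
  spannedBySample e S = (e ∈ᵇ span M (S ∩ C≥ i)) ∧ not (e ∈ᵇ S)

  Q : Subset n → Subset n
  Q S = setOf (λ e → (e ∈ᵇ (C i ∩ OPT)) ∧ spannedBySample e S)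

  record InQ (S : Subset n) (q : Fin n) : Set where
    field
      ∈C : q ∈ C i
      ∈OPT : q ∈ OPT
      spanned : Spans (S ∩ C≥ i) q
      ∉S : q ∉ S

  ∈Q⇒InQ : ∀ {S q} → q ∈ Q S → InQ S q
  ∈Q⇒InQ {S} {q} q∈Q with ∧-true⁻ (q ∈ᵇ (C i ∩ OPT)) (Equivalence.to ∈-setOf q∈Q)
  ... | q∈C∩OPT , rest with ∧-true⁻ (q ∈ᵇ span M (S ∩ C≥ i)) rest
  ... | q∈span , q∉ᵇS = record
    { ∈C = proj₁ (x∈p∩q⁻ (C i) OPT (∈ᵇ⇒∈ q∈C∩OPT))
    ; ∈OPT = proj₂ (x∈p∩q⁻ (C i) OPT (∈ᵇ⇒∈ q∈C∩OPT))
    ; spanned = Equivalence.to ∈-span⇔ (∈ᵇ⇒∈ q∈span)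
    ; ∉S = Equivalence.from ∉⇔not-∈ᵇ q∉ᵇS }

  module PerSample (S : Subset n) where

    open Sample M S
    open GreedyInContraction M S (B i) (Ngr i) (X i) (p∩q⊆p S (B≥ (suc i)))

    ∈Ngr : ∀ {j q} → q ∈ B (suc j) → Spans (S ∩ C≥ (suc j)) q → q ∈ Ngr (suc j)
    ∈Ngr {zero} q∈B _ = q∈B
    ∈Ngr {suc j} q∈B spanned = x∈p∩q⁺ (q∈B , Equivalence.from ∈-span⇔ (spans-mono sample⊆ spanned))
      where
        sample⊆ : S ∩ C≥ (suc (suc j)) ⊆ S ∩ B≥ (suc j)
        sample⊆ x∈ with x∈p∩q⁻ S _ x∈
        ... | x∈S , x∈C≥ = x∈p∩q⁺ (x∈S , C≥⊆B≥ (n≤1+n _) x∈C≥)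

    revealed : ∀ {q} → q ∉ S → q ∈ₗ order S
    revealed {q} q∉S = ∈-resp-↭ (↭-sym (order-reveals S))
      (∈-filter⁺ (T? ∘ λ e → not (e ∈ᵇ S)) (∈-allFin q) (Equivalence.from T-≡ (Equivalence.to ∉⇔not-∈ᵇ q∉S)))

    Tᵢ-invariant : Invariant (Tᵢ i (order S))
    Tᵢ-invariant = proj₁ (greedy (order S) invariant-⊥)

    Tᵢ-spans-candidates : ∀ {e} → e ∈ₗ order S → Candidate e → Spans (Tᵢ i (order S) ∪ X i) e
    Tᵢ-spans-candidates = proj₂ (proj₂ (greedy (order S) invariant-⊥))

    Tᵢ⊆C : Tᵢ i (order S) ⊆ C i
    Tᵢ⊆C = Equivalence.from C⇔B ∘ Invariant.⊆Bᵢ Tᵢ-invariant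

    ∣Q∣≤∣Tᵢ∣ : ∣ Q S ∣ ≤ℕ ∣ Tᵢ i (order S) ∣
    ∣Q∣≤∣Tᵢ∣ = ∣independent∣≤∣spanning∣ {T = Tᵢ i (order S)} Q∪Z-independent Q#Z Q-spanned X-spanned
      where
        Z : Subset n
        Z = heavyPart (threshold i)
        Q∪Z-independent : Independent (Q S ∪ Z)
        Q∪Z-independent = independent-⊆ (∪-least (InQ.∈OPT ∘ ∈Q⇒InQ) (heavyPart⊆OPT _)) OPT-independent
        Q#Z : Disjoint (Q S) Z
        Q#Z q∈Q q∈Z = ℚ.<-irrefl refl (ℚ.<-≤-trans (heavyPart-heavy q∈Z) (C-light {i} (InQ.∈C (∈Q⇒InQ q∈Q))))
        Q-spanned : ∀ {q} → q ∈ Q S → Spans (Tᵢ i (order S) ∪ X i) q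
        Q-spanned {q} q∈Q = Tᵢ-spans-candidates (revealed ∉S) (∉S , q∈B , ∈Ngr q∈B spanned)
          where
            open InQ (∈Q⇒InQ q∈Q)
            q∈B : q ∈ B i
            q∈B = Equivalence.to C⇔B ∈C
        X-spanned : ∀ {x} → x ∈ X i → Spans Z x
        X-spanned x∈X = heavyPart-spans-heavier (B≥-heavy (proj₂ (x∈p∩q⁻ S _ x∈X)))

    -- The parity test of Hset is bound in a where clause, so its instances for odd = true and
    -- odd = false are distinct functions, equal only pointwise.
    i∈H : i ∈ₗ Hset true ⊎ i ∈ₗ Hset false
    i∈H = ∈-filter-not⊎∈-filter _ _ (2-periodic-≗ _ _ refl refl (λ _ → refl) (λ _ → refl))
            (Equivalence.from ∈-range⇔ (ℕ.s≤s ℕ.z≤n , 1+k≤h))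

    ∣Q∣≤∣T∩C∣ : ∀ {odd} → i ∈ₗ Hset odd → ∣ Q S ∣ ≤ℕ ∣ T odd (order S) ∩ C i ∣
    ∣Q∣≤∣T∩C∣ i∈H = ≤-trans ∣Q∣≤∣Tᵢ∣ (p⊆q⇒∣p∣≤∣q∣ (∩-greatest (⊆-⋃ (λ j → Tᵢ j (order S)) i∈H) Tᵢ⊆C))

    sample-bound : ∣ Q S ∣ ≤ℕ ∣ T true (order S) ∩ C i ∣ +ℕ ∣ T false (order S) ∩ C i ∣
    sample-bound with i∈H
    ... | inj₁ i∈H₁ = ≤-trans (∣Q∣≤∣T∩C∣ i∈H₁) (m≤m+n _ _)
    ... | inj₂ i∈H₀ = ≤-trans (∣Q∣≤∣T∩C∣ i∈H₀) (m≤n+m _ _)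

  open Counting using (∣tabulate∣≡count; count-filter; sum-count-swap)
  open RationalArithmetic using (toℚ-+; toℚ-mono-≤; sumℚ-toℚ; sumℚ-*ʳ; sumℚ-mono-≤; halfPow-nonNeg)
  open UniformSampling using (condProb-∉-*½)
  open import Data.Nat.ListAction using (sum)
  open import Data.List.Properties using (map-cong)
  open import Data.Rational using (½; 1ℚ; _+_; _*_) renaming (_≤_ to _≤ℚ_)
  open import Data.Rational.Solver using (module +-*-Solver)

  E : List (Fin n)
  E = filterᵇ (λ e → e ∈ᵇ (C i ∩ OPT)) (allFin n)

  ∣Q∣≡count : ∀ S → ∣ Q S ∣ ≡ count (λ e → spannedBySample e S) E
  ∣Q∣≡count S = trans (∣tabulate∣≡count (λ e → e) (λ e → (e ∈ᵇ (C i ∩ OPT)) ∧ spannedBySample e S))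
                      (sym (count-filter (λ e → e ∈ᵇ (C i ∩ OPT)) (λ e → spannedBySample e S) (allFin n)))

  total : ℕ
  total = sum (map (λ S → ∣ Q S ∣) (allSubsets n))

  -- The probability of one outcome (S, H) at τ = 0, written as in condExpTC (halfPow 0 = 1ℚ).
  outcome-probability : ℚ
  outcome-probability = 1ℚ * (halfPow n * ½)

  lhs≡total : (½ * ½) * sumℚ (map (λ e → p M e i) E) ≡ toℚ total * outcome-probability
  lhs≡total = begin
    (½ * ½) * sumℚ (map (λ e → p M e i) E)
      ≡⟨ ℚ.*-assoc ½ ½ (sumℚ (map (λ e → p M e i) E)) ⟩
    ½ * (½ * sumℚ (map (λ e → p M e i) E))
      ≡⟨ cong (½ *_) (ℚ.*-comm ½ (sumℚ (map (λ e → p M e i) E))) ⟩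
    ½ * (sumℚ (map (λ e → p M e i) E) * ½)
      ≡⟨ cong (½ *_) (sumℚ-*ʳ (λ e → p M e i) ½ E) ⟨
    ½ * sumℚ (map (λ e → p M e i * ½) E)
      ≡⟨ cong (λ xs → ½ * sumℚ xs) (map-cong (λ e → condProb-∉-*½ (λ S → e ∈ᵇ span M (S ∩ C≥ i)) e) E) ⟩
    ½ * sumℚ (map (λ e → toℚ (count (spannedBySample e) (allSubsets n)) * halfPow n) E)
      ≡⟨ cong (½ *_) (sumℚ-*ʳ (λ e → toℚ (count (spannedBySample e) (allSubsets n))) (halfPow n) E) ⟩
    ½ * (sumℚ (map (λ e → toℚ (count (spannedBySample e) (allSubsets n))) E) * halfPow n)
      ≡⟨ cong (λ x → ½ * (x * halfPow n)) (sumℚ-toℚ (λ e → count (spannedBySample e) (allSubsets n)) E) ⟩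
    ½ * (toℚ (sum (map (λ e → count (spannedBySample e) (allSubsets n)) E)) * halfPow n)
      ≡⟨ cong (λ x → ½ * (toℚ x * halfPow n)) (sum-count-swap spannedBySample E (allSubsets n)) ⟩
    ½ * (toℚ (sum (map (λ S → count (λ e → spannedBySample e S) E) (allSubsets n))) * halfPow n)
      ≡⟨ cong (λ xs → ½ * (toℚ (sum xs) * halfPow n)) (map-cong (sym ∘ ∣Q∣≡count) (allSubsets n)) ⟩
    ½ * (toℚ total * halfPow n)
      ≡⟨ solve 3 (λ a x y → a :* (x :* y) := x :* (con 1ℚ :* (y :* a))) refl ½ (toℚ total) (halfPow n) ⟩
    toℚ total * outcome-probability ∎
    where
      open ≡-Reasoning
      open +-*-Solver

  -- The trailing 0ℚ's end the sums over H ∈ {H_odd, H_even} and over Δ ∈ upTo 1 in condExpTC.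
  total-≤-expectation : toℚ total * outcome-probability ≤ℚ condExpTC M order 0 i
  total-≤-expectation = begin
    toℚ total * K                                           ≡⟨ cong (_* K) (sumℚ-toℚ ∣Q∣ (allSubsets n)) ⟨
    sumℚ (map (toℚ ∘ ∣Q∣) (allSubsets n)) * K               ≡⟨ sumℚ-*ʳ (toℚ ∘ ∣Q∣) K (allSubsets n) ⟨
    sumℚ (map (λ S → toℚ ∣ Q S ∣ * K) (allSubsets n))       ≤⟨ sumℚ-mono-≤ per-sample (allSubsets n) ⟩
    sumℚ (map outputs (allSubsets n))                       ≡⟨ ℚ.+-identityʳ _ ⟨
    condExpTC M order 0 i                                   ∎
    where
      open ℚ.≤-Reasoning
      K : ℚ
      K = outcome-probability
      ∣Q∣ : Subset n → ℕ
      ∣Q∣ S = ∣ Q S ∣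
      found : Subset n → Bool → ℕ
      found S odd = ∣ Sample.T M S odd (order S) ∩ C i ∣
      outputs : Subset n → ℚ
      outputs S = toℚ (found S true) * K + (toℚ (found S false) * K + 0ℚ)
      per-sample : ∀ S → toℚ ∣ Q S ∣ * K ≤ℚ outputs S
      per-sample S = begin
        toℚ ∣ Q S ∣ * K                                     ≤⟨ ℚ.*-monoʳ-≤-nonNeg K {{K≥0}} (toℚ-mono-≤ (PerSample.sample-bound S)) ⟩
        toℚ (found S true +ℕ found S false) * K             ≡⟨ cong (_* K) (toℚ-+ (found S true) (found S false)) ⟩
        (toℚ (found S true) + toℚ (found S false)) * K      ≡⟨ ℚ.*-distribʳ-+ K (toℚ (found S true)) (toℚ (found S false)) ⟩
        toℚ (found S true) * K + toℚ (found S false) * K    ≡⟨ cong (toℚ (found S true) * K +_) (ℚ.+-identityʳ _) ⟨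
        outputs S                                           ∎
        where
          K≥0 : ℚ.NonNegative K
          K≥0 = ℚ.nonNeg*nonNeg⇒nonNeg 1ℚ (halfPow n * ½)
                  {{ℚ.nonNeg*nonNeg⇒nonNeg (halfPow n) {{ℚ.nonNegative (halfPow-nonNeg n)}} ½}}

open import Defs
open import Data.Nat using (ℕ; _∸_; _^_) renaming (_≤_ to _≤ℕ_; _+_ to _+ℕ_)
open import Data.Fin using (Fin)
open import Data.Fin.Subset using (Subset; _∩_)
open import Data.List using (List; map; filterᵇ; allFin)
open import Data.List.Relation.Binary.Permutation.Propositional using (_↭_)
open import Data.Bool using (true; not)
open import Data.Rational using (ℚ; 0ℚ; 1ℚ; _≤_; _<_; _*_; ½)
open import Function using (Injective)
open import Relation.Binary.PropositionalEquality using (_≡_)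
import Data.Rational.Properties

lemma5 : (n : ℕ) (M : Matroid n) (w : Fin n → ℚ) (W ρ̃ : ℚ) (h : ℕ) (OPT : Subset n)
    (order : Subset n → List (Fin n)) (i : ℕ) →
    (∀ e → 0ℚ < w e) → Injective _≡_ _≡_ w → 0ℚ < W → 1ℚ ≤ ρ̃ →
    3 ≤ℕ h → ρ̃ ≤ toℚ (2 ^ (h ∸ 3)) → (∀ k → ρ̃ ≤ toℚ (2 ^ k) → h ≤ℕ 3 +ℕ k) →
    indep M OPT ≡ true → (∀ I → indep M I ≡ true → weight w I ≤ weight w OPT) →
    (∀ S → order S ↭ filterᵇ (λ e → not (e ∈ᵇ S)) (allFin n)) →
    1 ≤ℕ i → i ≤ℕ h →
    (½ * ½) * sumℚ (map (λ e → Classes.p h W w M e i)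
                  (filterᵇ (λ e → e ∈ᵇ (Classes.C h W w i ∩ OPT)) (allFin n)))
      ≤ Classes.condExpTC h W w M order 0 i
lemma5 n M w W ρ̃ h OPT order (ℕ.suc k) w>0 _ W>0 _ _ _ _ OPT-independent OPT-maximum order-reveals _ i≤h = begin
  (½ * ½) * sumℚ (map (λ e → Classes.p h W w M e i) E)  ≡⟨ lhs≡total ⟩
  toℚ total * outcome-probability                       ≤⟨ total-≤-expectation ⟩
  Classes.condExpTC h W w M order 0 i                   ∎
  where
    open ExpectationBound M w W h OPT order k w>0 W>0 OPT-independent OPT-maximum order-reveals i≤h
    open Data.Rational.Properties.≤-Reasoning
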